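{- Let $K$ be a field, let $M$ be a matroid on $E=[d]$, and let $c\in E$ be an element that is not a coloop of $M$. Number the bases of $M$ as $B_1,\dots,B_n$ so that $c\notin B_j$ for $j\in[\gamma]$ and $c\in B_j$ for $j\in[n]\setminus[\gamma]$. If $\mathbf F$ is a generating set, consisting of homogeneous binomials, of the toric ideal $J_{\mathcal D_M}=\ker(\pi_M)\subset K[x^1_1,\dots,x^1_n]$, then the set $\widetilde{\mathbf F}$ constructed from $\mathbf F$ as described in the context generates the toric ideal $J_{\widetilde{\mathcal D}_M}=\ker(\widetilde\pi_M)\subset K[x^1_1,\dots,x^1_n,x^2_1,\dots,x^2_\gamma]$.
   Context: For a matroid $M$ on $[d]$ with bases $B_1,\dots,B_n$, let $\mathbf b_j=\sum_{l\in B_j}\mathbf e_l\in\mathbb Z^d$ and let $\pi_M:K[x^1_1,\dots,x^1_n]\to K[s_1,\dots,s_d]$ be the ring homomorphism $x^1_j\mapsto \prod_{l\in B_j}s_l$; its kernel is $J_{\mathcal D_M}$. Let $\widetilde{\mathcal D}_M$ be the integer matrix whose columns are $(\mathbf b_j,\mathbf e_1)$ for $j\in[n]$ followed by $(\mathbf b_j,\mathbf e_2)$ for $j\in[\gamma]$ (here $\mathbf e_1,\mathbf e_2\in\mathbb Z^2$), and let $\widetilde\pi_M:K[x^1_1,\dots,x^1_n,x^2_1,\dots,x^2_\gamma]\to K[s_1,\dots,s_d,w_1,w_2]$ be given by $x^i_j\mapsto \big(\prod_{l\in B_j}s_l\big)w_i$; $J_{\widetilde{\mathcal D}_M}=\ker\widetilde\pi_M$.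 Construction of $\widetilde{\mathbf F}$: each $f\in\mathbf F$ is written as $f=\prod_{l=1}^{u_f}x^1_{j_l}\prod_{l=1}^{v_f}x^1_{k_l}-\prod_{l=1}^{u'_f}x^1_{j'_l}\prod_{l=1}^{v'_f}x^1_{k'_l}$ with $j_l,j'_l\in[\gamma]$ and $k_l,k'_l\in[n]\setminus[\gamma]$ (factors listed in a fixed order); necessarily $u_f=u'_f$ and $v_f=v'_f$. For $I=(i_1,\dots,i_{u_f})\in\{1,2\}^{u_f}$ put $f^I=\prod_{l=1}^{u_f}x^{i_l}_{j_l}\prod_{l=1}^{v_f}x^1_{k_l}-\prod_{l=1}^{u_f}x^{i_l}_{j'_l}\prod_{l=1}^{v_f}x^1_{k'_l}$. Then $\widetilde{\mathbf F}=\{f^I: f\in\mathbf F,\ I\in\{1,2\}^{u_f}\}\cup\{x^1_{j_2}x^2_{j_1}-x^1_{j_1}x^2_{j_2}: 1\le j_1<j_2\le\gamma\}$. -}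

module Defs where

open import Level using (Level; _⊔_) renaming (suc to lsuc)
open import Algebra.Bundles using (CommutativeRing)
open import Data.Nat as ℕ using (ℕ; zero; suc; _<_; _≤_; _<?_)
open import Data.Fin as Fin using (Fin; toℕ; _↑ˡ_; _↑ʳ_; inject≤; fromℕ<; splitAt)
open import Data.Fin.Subset using (Subset; _∈_; _∉_; _∪_; _-_; ⁅_⁆)
open import Data.Bool using (Bool; true; false; if_then_else_)
open import Data.List as List using (List; []; _∷_; _++_; foldr; concatMap; filter; length)
open import Data.List.Relation.Unary.All using (All)
open import Data.Vec as Vec using (Vec; []; _∷_; tabulate; zipWith; replicate; toList)
open import Data.Vec.Properties using (≡-dec)
open import Data.Product using (Σ; ∃; ∃-syntax; _×_; _,_; proj₁; proj₂)
open import Data.Sum using (_⊎_; inj₁; inj₂)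
open import Function using (_∘_; Injective)
open import Relation.Nullary using (¬_; yes; no)
open import Relation.Binary.PropositionalEquality using (_≡_)

record Field (c ℓ : Level) : Set (lsuc (c ⊔ ℓ)) where
  field
    commutativeRing : CommutativeRing c ℓ
  open CommutativeRing commutativeRing public
  field
    0≉1     : ¬ (0# ≈ 1#)
    inverse : ∀ x → ¬ (x ≈ 0#) → ∃[ y ] (x * y ≈ 1#)

record Matroid (d : ℕ) : Set₁ where
  field
    IsBase      : Subset d → Set
    base-exists : ∃[ B ] IsBase B
    exchange    : ∀ {B₁ B₂} → IsBase B₁ → IsBase B₂ →
                  ∀ {x} → x ∈ B₁ → x ∉ B₂ →
                  ∃[ y ] (y ∈ B₂ × y ∉ B₁ × IsBase ((B₁ - x) ∪ ⁅ y ⁆))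

open Matroid public

IsColoop : ∀ {d} → Matroid d → Fin d → Set
IsColoop M c = ∀ B → IsBase M B → c ∈ B

IsBaseNumbering : ∀ {d n} → Matroid d → (Fin n → Subset d) → Set
IsBaseNumbering M B =
  (∀ j → IsBase M (B j)) × Injective _≡_ _≡_ B × (∀ X → IsBase M X → ∃[ j ] (B j ≡ X))

indicator : ∀ {d} → Subset d → Vec ℕ d
indicator = Vec.map (λ b → if b then 1 else 0)

-- Polynomial rings K[z₁,…,z_m]: a polynomial is a finite formal sum of
-- terms (coefficient, exponent vector); two polynomials are equal iff
-- all their coefficients agree (in K's equality).

module PolyRing {c ℓ} (K : Field c ℓ) where
  open Field K

  Mon : ℕ → Set
  Mon m = Vec ℕ m

  Poly : ℕ → Set c
  Poly m = List (Carrier × Mon m)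

  coeff : ∀ {m} → Poly m → Mon m → Carrier
  coeff [] α = 0#
  coeff ((a , β) ∷ p) α with ≡-dec ℕ._≟_ β α
  ... | yes _ = a + coeff p α
  ... | no _  = coeff p α

  _≈P_ : ∀ {m} → Poly m → Poly m → Set ℓ
  p ≈P q = ∀ α → coeff p α ≈ coeff q α

  0P : ∀ {m} → Poly m
  0P = []

  _+P_ : ∀ {m} → Poly m → Poly m → Poly m
  p +P q = p ++ q

  -P_ : ∀ {m} → Poly m → Poly m
  -P p = List.map (λ { (a , α) → (- a , α) }) p

  _*P_ : ∀ {m} → Poly m → Poly m → Poly m
  p *P q = concatMap (λ { (a , α) → List.map (λ { (b , β) → (a * b , zipWith ℕ._+_ α β) }) q }) p

  sumP : ∀ {m} → List (Poly m) → Poly m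
  sumP = foldr _+P_ 0P

  -- exponent vector of the monomial ∏_{i ∈ u} z_i (u a list of factors)
  expOf : ∀ {m} → List (Fin m) → Mon m
  expOf u = tabulate (λ i → length (filter (Fin._≟ i) u))

  -- Pure binomials z^u − z^v, given by their (ordered) lists of factors.
  Binom : ℕ → Set
  Binom m = List (Fin m) × List (Fin m)

  ⟦_⟧ : ∀ {m} → Binom m → Poly m
  ⟦ u , v ⟧ = (1# , expOf u) ∷ (- 1# , expOf v) ∷ []

  Homogeneous : ∀ {m f} → (Binom m → Set f) → Set f
  Homogeneous F = ∀ b → F b → List.length (proj₁ b) ≡ List.length (proj₂ b)

  InIdeal : ∀ {m f} → (Binom m → Set f) → Poly m → Set (c ⊔ ℓ ⊔ f)
  InIdeal G p = ∃[ gs ] (All (G ∘ proj₂) gs ×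
                         p ≈P sumP (List.map (λ { (g , b) → g *P ⟦ b ⟧ }) gs))

  -- K-algebra homomorphism K[z₁..z_m] → K[y₁..y_k] sending z_i to the
  -- monomial y^{img i}.
  expImage : ∀ {m k} → (Fin m → Mon k) → Mon m → Mon k
  expImage img [] = replicate _ 0
  expImage img (a ∷ α) = zipWith ℕ._+_ (Vec.map (a ℕ.*_) (img Fin.zero))
                                       (expImage (img ∘ Fin.suc) α)

  monoMap : ∀ {m k} → (Fin m → Mon k) → Poly m → Poly k
  monoMap img = List.map (λ { (a , α) → (a , expImage img α) })

  GeneratesKernel : ∀ {m k f} → (Binom m → Set f) → (Fin m → Mon k) → Set (c ⊔ ℓ ⊔ f)
  GeneratesKernel G img = ∀ p → (InIdeal G p → monoMap img p ≈P 0P)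
                              × (monoMap img p ≈P 0P → InIdeal G p)

  -- The maps π_M and π̃_M.  Variables of the big ring are Fin (n + γ):
  -- x^1_j = j ↑ˡ γ (j : Fin n), x^2_j = n ↑ʳ j (j : Fin γ).

  πImg : ∀ {d n} → (Fin n → Subset d) → Fin n → Mon d
  πImg B j = indicator (B j)

  π̃Img : ∀ {d n γ} → (Fin n → Subset d) → γ ≤ n → Fin (n ℕ.+ γ) → Mon (d ℕ.+ 2)
  π̃Img {n = n} B γ≤n i with splitAt n i
  ... | inj₁ j = indicator (B j) Vec.++ (1 ∷ 0 ∷ [])
  ... | inj₂ j = indicator (B (inject≤ j γ≤n)) Vec.++ (0 ∷ 1 ∷ [])

  x¹ : ∀ {n γ} → Fin n → Fin (n ℕ.+ γ)
  x¹ {γ = γ} j = j ↑ˡ γ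

  x² : ∀ {n γ} → Fin γ → Fin (n ℕ.+ γ)
  x² {n = n} j = n ↑ʳ j

  countγ : ∀ {n} → ℕ → List (Fin n) → ℕ
  countγ γ u = length (filter (λ j → toℕ j <? γ) u)

  -- relabel the factors x^1_j, j ∈ [γ], in order, with the superscripts
  -- listed in I (Fin 2: zero = superscript 1, suc zero = superscript 2)
  relabel : ∀ {n γ} → List (Fin 2) → List (Fin n) → List (Fin (n ℕ.+ γ))
  relabel I [] = []
  relabel {γ = γ} I (j ∷ u) with toℕ j <? γ
  ... | no _ = x¹ j ∷ relabel I u
  relabel {γ = γ} [] (j ∷ u) | yes _ = x¹ j ∷ relabel [] u
  relabel {γ = γ} (Fin.zero ∷ I) (j ∷ u) | yes _ = x¹ j ∷ relabel I u
  relabel {γ = γ} (Fin.suc _ ∷ I) (j ∷ u) | yes j<γ = x² (fromℕ< j<γ) ∷ relabel I u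

  liftBinom : ∀ {n γ} → List (Fin 2) → Binom n → Binom (n ℕ.+ γ)
  liftBinom {γ = γ} I (u , v) = relabel {γ = γ} I u , relabel {γ = γ} I v

  Ftilde : ∀ {n f} (γ : ℕ) → γ ≤ n → (Binom n → Set f) → Binom (n ℕ.+ γ) → Set f
  Ftilde {n} γ γ≤n F b =
      (∃[ fb ] (F fb × ∃[ I ] (b ≡ liftBinom {γ = γ} (toList {n = countγ γ (proj₁ fb)} I) fb)))
    ⊎ (∃[ j₁ ] ∃[ j₂ ] (j₁ Fin.< j₂ ×
        b ≡ ((x¹ (inject≤ j₂ γ≤n) ∷ x² j₁ ∷ []) , (x¹ (inject≤ j₁ γ≤n) ∷ x² j₂ ∷ []))))

-- Variables of the big ring are x¹ⱼ (j ∈ [n]) and x²ⱼ (j ∈ [γ]); the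
-- w₂-degree of a monomial is its number of factors with superscript 2.
--
-- ⟨F̃⟩ ⊆ ker π̃: every f^I is balanced for π̃, because f is balanced for π
-- and both sides of f have equally many factors with index in [γ] (the
-- c-th coordinate of π counts the factors outside [γ], and F is
-- homogeneous); the swap binomials are balanced by inspection.
--
-- ker π̃ ⊆ ⟨F̃⟩: modulo the swap binomials every monomial x^α is congruent to
-- its normal form lift_k(σ α), where σ forgets superscripts and k is the
-- w₂-degree of α: superscript 2 on the first k factors with index in [γ].
-- lift_k maps multiples of f ∈ F to multiples of some f^I, hence ⟨F⟩ into
-- ⟨F̃⟩.  A kernel polynomial splits into kernel polynomials P of fixed
-- w₂-degree k; then P − lift_k(σ P) ∈ ⟨F̃⟩ and σ P ∈ ker π = ⟨F⟩.

module Submission where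

open import Defs
open import Level using (Level; _⊔_)
open import Data.Nat as ℕ using (ℕ; zero; suc; _<_; _≤_; _<?_; _∸_)
import Data.Nat.Properties as ℕP
open import Data.Fin as Fin using (Fin; toℕ; _↑ʳ_; splitAt; inject≤; fromℕ<)
import Data.Fin.Properties as FinP
open import Data.Fin.Subset using (Subset; _∈_; _∉_)
open import Data.Bool using (true; false; if_then_else_)
open import Data.List as List using (List; []; _∷_; _++_; filter; length)
import Data.List.Properties as ListP
open import Data.List.Relation.Unary.All as All using (All; []; _∷_)
import Data.List.Relation.Unary.All.Properties as AllP
open import Data.List.Relation.Binary.Permutation.Propositional as Perm using (_↭_)
import Data.List.Relation.Binary.Permutation.Propositional.Properties as PermP
open import Data.Vec as Vec using (Vec; []; _∷_)
import Data.Vec.Properties as VecP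
open VecP using (≡-dec)
open import Data.Product using (∃-syntax; _×_; _,_; proj₁; proj₂)
open import Data.Sum using (inj₁; inj₂; [_,_]′)
open import Data.Empty using (⊥-elim)
open import Function using (_∘_)
open import Relation.Binary using (tri<; tri≈; tri>)
open import Relation.Binary.PropositionalEquality as ≡ using (_≡_; _≢_; refl; cong; cong₂)
open import Relation.Nullary using (¬_; Dec; yes; no; ¬?)
open import Relation.Unary using (Decidable)

module Exponents {c ℓ} (K : Field c ℓ) where
  open PolyRing K using (Mon; expOf; expImage)

  infixl 6 _⊕_

  _⊕_ : ∀ {m} → Mon m → Mon m → Mon m
  _⊕_ = Vec.zipWith ℕ._+_

  0⃗ : ∀ {m} → Mon m
  0⃗ = Vec.replicate _ 0

  ⊕-assoc : ∀ {m} (x y z : Mon m) → (x ⊕ y) ⊕ z ≡ x ⊕ (y ⊕ z)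
  ⊕-assoc = VecP.zipWith-assoc ℕP.+-assoc

  ⊕-comm : ∀ {m} (x y : Mon m) → x ⊕ y ≡ y ⊕ x
  ⊕-comm = VecP.zipWith-comm ℕP.+-comm

  ⊕-identityˡ : ∀ {m} (x : Mon m) → 0⃗ ⊕ x ≡ x
  ⊕-identityˡ = VecP.zipWith-identityˡ ℕP.+-identityˡ

  ⊕-identityʳ : ∀ {m} (x : Mon m) → x ⊕ 0⃗ ≡ x
  ⊕-identityʳ = VecP.zipWith-identityʳ ℕP.+-identityʳ

  ⊕-interchange : ∀ {m} (x y z w : Mon m) → (x ⊕ y) ⊕ (z ⊕ w) ≡ (x ⊕ z) ⊕ (y ⊕ w)
  ⊕-interchange x y z w = begin
    (x ⊕ y) ⊕ (z ⊕ w)  ≡⟨ ⊕-assoc x y (z ⊕ w) ⟩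
    x ⊕ (y ⊕ (z ⊕ w))  ≡⟨ cong (x ⊕_) (≡.sym (⊕-assoc y z w)) ⟩
    x ⊕ ((y ⊕ z) ⊕ w)  ≡⟨ cong (λ v → x ⊕ (v ⊕ w)) (⊕-comm y z) ⟩
    x ⊕ ((z ⊕ y) ⊕ w)  ≡⟨ cong (x ⊕_) (⊕-assoc z y w) ⟩
    x ⊕ (z ⊕ (y ⊕ w))  ≡⟨ ≡.sym (⊕-assoc x z (y ⊕ w)) ⟩
    (x ⊕ z) ⊕ (y ⊕ w)  ∎
    where open ≡.≡-Reasoning

  lookup-⊕ : ∀ {m} (x y : Mon m) i → Vec.lookup (x ⊕ y) i ≡ Vec.lookup x i ℕ.+ Vec.lookup y i
  lookup-⊕ x y i = VecP.lookup-zipWith ℕ._+_ i x y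

  Mon-ext : ∀ {m} {v w : Mon m} → (∀ i → Vec.lookup v i ≡ Vec.lookup w i) → v ≡ w
  Mon-ext {v = v} {w} e =
    ≡.trans (≡.sym (VecP.tabulate∘lookup v)) (≡.trans (VecP.tabulate-cong e) (VecP.tabulate∘lookup w))

  multiplicity : ∀ {m} → Fin m → List (Fin m) → ℕ
  multiplicity i u = length (filter (Fin._≟ i) u)

  lookup-expOf : ∀ {m} (u : List (Fin m)) i → Vec.lookup (expOf u) i ≡ multiplicity i u
  lookup-expOf u i = VecP.lookup∘tabulate _ i

  multiplicity-++ : ∀ {m} (i : Fin m) u w → multiplicity i (u ++ w) ≡ multiplicity i u ℕ.+ multiplicity i w
  multiplicity-++ i u w =
    ≡.trans (cong length (ListP.filter-++ (Fin._≟ i) u w)) (ListP.length-++ (filter (Fin._≟ i) u))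

  expOf-[] : ∀ {m} → expOf {m} [] ≡ 0⃗
  expOf-[] = Mon-ext λ i → ≡.trans (lookup-expOf [] i) (≡.sym (VecP.lookup-replicate i 0))

  expOf-++ : ∀ {m} (u w : List (Fin m)) → expOf (u ++ w) ≡ expOf u ⊕ expOf w
  expOf-++ u w = Mon-ext λ i → begin
    Vec.lookup (expOf (u ++ w)) i                         ≡⟨ lookup-expOf (u ++ w) i ⟩
    multiplicity i (u ++ w)                               ≡⟨ multiplicity-++ i u w ⟩
    multiplicity i u ℕ.+ multiplicity i w                 ≡⟨ cong₂ ℕ._+_ (lookup-expOf u i) (lookup-expOf w i) ⟨
    Vec.lookup (expOf u) i ℕ.+ Vec.lookup (expOf w) i     ≡⟨ lookup-⊕ (expOf u) (expOf w) i ⟨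
    Vec.lookup (expOf u ⊕ expOf w) i                      ∎
    where open ≡.≡-Reasoning

  expOf-↭ : ∀ {m} {u w : List (Fin m)} → u ↭ w → expOf u ≡ expOf w
  expOf-↭ Perm.refl = refl
  expOf-↭ (Perm.prep {xs = u} {ys = w} x p) =
    ≡.trans (expOf-++ (x ∷ []) u) (≡.trans (cong (expOf (x ∷ []) ⊕_) (expOf-↭ p)) (≡.sym (expOf-++ (x ∷ []) w)))
  expOf-↭ (Perm.swap {xs = u} {ys = w} x y p) =
    ≡.trans (expOf-++ (x ∷ y ∷ []) u) (≡.trans (cong₂ _⊕_ xy≡yx (expOf-↭ p)) (≡.sym (expOf-++ (y ∷ x ∷ []) w)))
    where
    xy≡yx : expOf (x ∷ y ∷ []) ≡ expOf (y ∷ x ∷ [])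
    xy≡yx = ≡.trans (expOf-++ (x ∷ []) (y ∷ [])) (≡.trans (⊕-comm _ _) (≡.sym (expOf-++ (y ∷ []) (x ∷ []))))
  expOf-↭ (Perm.trans p q) = ≡.trans (expOf-↭ p) (expOf-↭ q)

  expOf-zero : ∀ {m} → expOf {suc m} (Fin.zero ∷ []) ≡ 1 ∷ 0⃗
  expOf-zero = Mon-ext λ
    { Fin.zero → refl
    ; (Fin.suc i) → ≡.trans (lookup-expOf (Fin.zero ∷ []) (Fin.suc i)) (≡.sym (VecP.lookup-replicate i 0)) }

  expOf-suc : ∀ {m} (y : Fin m) → expOf (Fin.suc y ∷ []) ≡ 0 ∷ expOf (y ∷ [])
  expOf-suc y = Mon-ext λ
    { Fin.zero → refl
    ; (Fin.suc i) → ≡.trans (lookup-expOf (Fin.suc y ∷ []) (Fin.suc i))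
                      (≡.trans (same-test i) (≡.sym (lookup-expOf (y ∷ []) i))) }
    where
    same-test : ∀ i → multiplicity (Fin.suc i) (Fin.suc y ∷ []) ≡ multiplicity i (y ∷ [])
    same-test i with y Fin.≟ i
    ... | yes refl = refl
    ... | no _ = refl

  sumV : ∀ {k} → List (Mon k) → Mon k
  sumV = List.foldr _⊕_ 0⃗

  0-scale : ∀ {k} (v : Mon k) → Vec.map (0 ℕ.*_) v ≡ 0⃗
  0-scale [] = refl
  0-scale (_ ∷ v) = cong (0 ∷_) (0-scale v)

  1-scale : ∀ {k} (v : Mon k) → Vec.map (1 ℕ.*_) v ≡ v
  1-scale [] = refl
  1-scale (x ∷ v) = cong₂ _∷_ (ℕP.*-identityˡ x) (1-scale v)

  +-scale : ∀ {k} a b (v : Mon k) → Vec.map ((a ℕ.+ b) ℕ.*_) v ≡ Vec.map (a ℕ.*_) v ⊕ Vec.map (b ℕ.*_) v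
  +-scale a b [] = refl
  +-scale a b (x ∷ v) = cong₂ _∷_ (ℕP.*-distribʳ-+ x a b) (+-scale a b v)

  expImage-0 : ∀ {m k} (img : Fin m → Mon k) → expImage img 0⃗ ≡ 0⃗
  expImage-0 {zero} img = refl
  expImage-0 {suc m} img =
    ≡.trans (cong₂ _⊕_ (0-scale (img Fin.zero)) (expImage-0 (img ∘ Fin.suc))) (⊕-identityˡ 0⃗)

  expImage-⊕ : ∀ {m k} (img : Fin m → Mon k) α β →
               expImage img (α ⊕ β) ≡ expImage img α ⊕ expImage img β
  expImage-⊕ img [] [] = ≡.sym (⊕-identityˡ 0⃗)
  expImage-⊕ img (a ∷ α) (b ∷ β) =
    ≡.trans (cong₂ _⊕_ (+-scale a b (img Fin.zero)) (expImage-⊕ (img ∘ Fin.suc) α β)) (⊕-interchange _ _ _ _)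

  expImage-variable : ∀ {m k} (img : Fin m → Mon k) x → expImage img (expOf (x ∷ [])) ≡ img x
  expImage-variable {suc m} img Fin.zero =
    ≡.trans (cong (expImage img) (expOf-zero {m}))
      (≡.trans (cong₂ _⊕_ (1-scale (img Fin.zero)) (expImage-0 (img ∘ Fin.suc))) (⊕-identityʳ _))
  expImage-variable img (Fin.suc y) =
    ≡.trans (cong (expImage img) (expOf-suc y))
      (≡.trans (cong₂ _⊕_ (0-scale (img Fin.zero)) (expImage-variable (img ∘ Fin.suc) y)) (⊕-identityˡ _))

  expImage-expOf : ∀ {m k} (img : Fin m → Mon k) u → expImage img (expOf u) ≡ sumV (List.map img u)
  expImage-expOf img [] = ≡.trans (cong (expImage img) expOf-[]) (expImage-0 img)
  expImage-expOf img (x ∷ u) =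
    ≡.trans (cong (expImage img) (expOf-++ (x ∷ []) u))
      (≡.trans (expImage-⊕ img (expOf (x ∷ [])) (expOf u))
        (cong₂ _⊕_ (expImage-variable img x) (expImage-expOf img u)))

  factors : ∀ {m} → Mon m → List (Fin m)
  factors [] = []
  factors (a ∷ α) = List.replicate a Fin.zero ++ List.map Fin.suc (factors α)

  expOf-factors : ∀ {m} (α : Mon m) → expOf (factors α) ≡ α
  expOf-factors [] = refl
  expOf-factors (a ∷ α) = begin
    expOf (List.replicate a Fin.zero ++ List.map Fin.suc (factors α))
      ≡⟨ expOf-++ (List.replicate a Fin.zero) _ ⟩
    expOf (List.replicate a Fin.zero) ⊕ expOf (List.map Fin.suc (factors α))
      ≡⟨ cong₂ _⊕_ (expOf-replicate a) (expOf-map-suc (factors α)) ⟩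
    (a ∷ 0⃗) ⊕ (0 ∷ expOf (factors α))
      ≡⟨ cong₂ _∷_ (ℕP.+-identityʳ a) (≡.trans (⊕-identityˡ _) (expOf-factors α)) ⟩
    a ∷ α ∎
    where
    open ≡.≡-Reasoning
    expOf-replicate : ∀ {m} a → expOf {suc m} (List.replicate a Fin.zero) ≡ a ∷ 0⃗
    expOf-replicate zero = expOf-[]
    expOf-replicate (suc a) =
      ≡.trans (expOf-++ (Fin.zero ∷ []) (List.replicate a Fin.zero))
        (≡.trans (cong₂ _⊕_ expOf-zero (expOf-replicate a)) (cong (suc a ∷_) (⊕-identityˡ 0⃗)))
    expOf-map-suc : ∀ {m} (w : List (Fin m)) → expOf (List.map Fin.suc w) ≡ 0 ∷ expOf w
    expOf-map-suc [] = ≡.trans expOf-[] (cong (0 ∷_) (≡.sym expOf-[]))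
    expOf-map-suc (x ∷ w) =
      ≡.trans (expOf-++ (Fin.suc x ∷ []) (List.map Fin.suc w))
        (≡.trans (cong₂ _⊕_ (expOf-suc x) (expOf-map-suc w)) (cong (0 ∷_) (≡.sym (expOf-++ (x ∷ []) w))))

  factors-0 : ∀ {m} → factors {m} 0⃗ ≡ []
  factors-0 {zero} = refl
  factors-0 {suc m} = cong (List.map Fin.suc) (factors-0 {m})

  factors-variable-⊕ : ∀ {m} (x : Fin m) (α : Mon m) → factors (expOf (x ∷ []) ⊕ α) ↭ x ∷ factors α
  factors-variable-⊕ {suc m} Fin.zero (a ∷ α) =
    Perm.↭-reflexive (cong factors (≡.trans (cong (_⊕ (a ∷ α)) (expOf-zero {m})) (cong (suc a ∷_) (⊕-identityˡ α))))
  factors-variable-⊕ {suc m} (Fin.suc y) (a ∷ α) =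
    Perm.trans (Perm.↭-reflexive (cong factors (cong (_⊕ (a ∷ α)) (expOf-suc y))))
      (Perm.trans (PermP.++⁺ˡ (List.replicate a Fin.zero) (PermP.map⁺ Fin.suc (factors-variable-⊕ y α)))
        (PermP.shift (Fin.suc y) (List.replicate a Fin.zero) (List.map Fin.suc (factors α))))

  factors-expOf : ∀ {m} (w : List (Fin m)) → factors (expOf w) ↭ w
  factors-expOf [] = Perm.↭-reflexive (≡.trans (cong factors expOf-[]) factors-0)
  factors-expOf (x ∷ w) =
    Perm.trans (Perm.↭-reflexive (cong factors (expOf-++ (x ∷ []) w)))
      (Perm.trans (factors-variable-⊕ x (expOf w)) (Perm.prep x (factors-expOf w)))

-- The
-- central fact is mapExp-zero: renaming exponents along any function h
-- (in particular applying a monomial map) sends zero polynomials to zero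
-- polynomials, hence respects equality of polynomials.

module Coefficients {c ℓ} (K : Field c ℓ) where
  open Field K renaming (refl to ≈-refl; sym to ≈-sym; trans to ≈-trans)
  open PolyRing K
  open import Algebra.Properties.Ring ring using (-‿+-comm; -0#≈0#; x∙y⁻¹≈ε⇒x≈y)
  open import Algebra.Properties.CommutativeSemigroup +-commutativeSemigroup using (x∙yz≈y∙xz)
  open import Relation.Binary.Reasoning.Setoid setoid

  Term : ℕ → Set c
  Term m = Carrier × Mon m

  mapExp : ∀ {m m'} → (Mon m → Mon m') → Poly m → Poly m'
  mapExp h = List.map (λ t → proj₁ t , h (proj₂ t))

  scale : ∀ {m} → Carrier → Poly m → Poly m
  scale a = List.map (λ t → a * proj₁ t , proj₂ t)

  IsZero : ∀ {m} → Poly m → Set ℓ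
  IsZero p = p ≈P 0P

  coeff-++ : ∀ {m} (p q : Poly m) α → coeff (p ++ q) α ≈ coeff p α + coeff q α
  coeff-++ [] q α = ≈-sym (+-identityˡ _)
  coeff-++ ((a , β) ∷ p) q α with ≡-dec ℕ._≟_ β α
  ... | yes _ = ≈-trans (+-congˡ (coeff-++ p q α)) (≈-sym (+-assoc _ _ _))
  ... | no _ = coeff-++ p q α

  coeff-neg : ∀ {m} (p : Poly m) α → coeff (-P p) α ≈ - coeff p α
  coeff-neg [] α = ≈-sym -0#≈0#
  coeff-neg ((a , β) ∷ p) α with ≡-dec ℕ._≟_ β α
  ... | yes _ = ≈-trans (+-congˡ (coeff-neg p α)) (-‿+-comm a (coeff p α))
  ... | no _ = coeff-neg p α

  coeff-scale : ∀ {m} a (p : Poly m) α → coeff (scale a p) α ≈ a * coeff p α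
  coeff-scale a [] α = ≈-sym (zeroʳ a)
  coeff-scale a ((b , β) ∷ p) α with ≡-dec ℕ._≟_ β α
  ... | yes _ = ≈-trans (+-congˡ (coeff-scale a p α)) (≈-sym (distribˡ a b (coeff p α)))
  ... | no _ = coeff-scale a p α

  _⊝_ : ∀ {m} → Poly m → Poly m → Poly m
  p ⊝ q = p ++ -P q

  coeff-⊝ : ∀ {m} (p q : Poly m) α → coeff (p ⊝ q) α ≈ coeff p α + - coeff q α
  coeff-⊝ p q α = ≈-trans (coeff-++ p (-P q) α) (+-congˡ (coeff-neg q α))

  ⊝-zero : ∀ {m} {p q : Poly m} → p ≈P q → IsZero (p ⊝ q)
  ⊝-zero {p = p} {q} e α = ≈-trans (coeff-⊝ p q α) (≈-trans (+-congʳ (e α)) (-‿inverseʳ _))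

  zero-⊝ : ∀ {m} {p q : Poly m} → IsZero (p ⊝ q) → p ≈P q
  zero-⊝ {p = p} {q} z α = x∙y⁻¹≈ε⇒x≈y _ _ (≈-trans (≈-sym (coeff-⊝ p q α)) (z α))

  data _≐_ {m} : Poly m → Poly m → Set (c ⊔ ℓ) where
    []   : [] ≐ []
    term : ∀ {a b α β p q} → a ≈ b → α ≡ β → p ≐ q → ((a , α) ∷ p) ≐ ((b , β) ∷ q)

  ≐⇒≈P : ∀ {m} {p q : Poly m} → p ≐ q → p ≈P q
  ≐⇒≈P [] α = ≈-refl
  ≐⇒≈P (term {α = β} e refl r) α with ≡-dec ℕ._≟_ β α
  ... | yes _ = +-cong e (≐⇒≈P r α)
  ... | no _ = ≐⇒≈P r α

  ≐-++ : ∀ {m} {p q p' q' : Poly m} → p ≐ q → p' ≐ q' → (p ++ p') ≐ (q ++ q')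
  ≐-++ [] r = r
  ≐-++ (term e e' r) r' = term e e' (≐-++ r r')

  coeff-mapExp-split : ∀ {m m' p} {P : Term m → Set p} (P? : Decidable P) (h : Mon m → Mon m') q α →
    coeff (mapExp h q) α ≈ coeff (mapExp h (filter P? q)) α + coeff (mapExp h (filter (¬? ∘ P?) q)) α
  coeff-mapExp-split P? h [] α = ≈-sym (+-identityˡ _)
  coeff-mapExp-split P? h ((a , β) ∷ q) α with P? (a , β)
  ... | yes _ with ≡-dec ℕ._≟_ (h β) α
  ...   | yes _ = ≈-trans (+-congˡ (coeff-mapExp-split P? h q α)) (≈-sym (+-assoc _ _ _))
  ...   | no _  = coeff-mapExp-split P? h q α
  coeff-mapExp-split P? h ((a , β) ∷ q) α | no _ with ≡-dec ℕ._≟_ (h β) α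
  ...   | yes _ = ≈-trans (+-congˡ (coeff-mapExp-split P? h q α)) (x∙yz≈y∙xz _ _ _)
  ...   | no _  = coeff-mapExp-split P? h q α

  mapExp-id : ∀ {m} (p : Poly m) → mapExp (λ α → α) p ≡ p
  mapExp-id [] = refl
  mapExp-id (t ∷ p) = cong (t ∷_) (mapExp-id p)

  coeff-split : ∀ {m p} {P : Term m → Set p} (P? : Decidable P) (q : Poly m) α →
    coeff q α ≈ coeff (filter P? q) α + coeff (filter (¬? ∘ P?) q) α
  coeff-split P? q α with coeff-mapExp-split P? (λ α → α) q α
  ... | split rewrite mapExp-id q | mapExp-id (filter P? q) | mapExp-id (filter (¬? ∘ P?) q) = split

  mapExp-∘ : ∀ {a b e} (h₁ : Mon b → Mon e) (h₂ : Mon a → Mon b) p → mapExp h₁ (mapExp h₂ p) ≡ mapExp (h₁ ∘ h₂) p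
  mapExp-∘ h₁ h₂ [] = refl
  mapExp-∘ h₁ h₂ (t ∷ p) = cong (_ ∷_) (mapExp-∘ h₁ h₂ p)

  mapExp-cong : ∀ {a b} {h₁ h₂ : Mon a → Mon b} → (∀ α → h₁ α ≡ h₂ α) → ∀ p → mapExp h₁ p ≡ mapExp h₂ p
  mapExp-cong e [] = refl
  mapExp-cong e ((a , α) ∷ p) = cong₂ _∷_ (cong (a ,_) (e α)) (mapExp-cong e p)

  mapExp-⊝ : ∀ {m m'} (h : Mon m → Mon m') (p q : Poly m) → mapExp h (p ⊝ q) ≡ mapExp h p ⊝ mapExp h q
  mapExp-⊝ h p q = ≡.trans (ListP.map-++ _ p (-P q)) (cong (mapExp h p ++_) (map-neg q))
    where
    map-neg : ∀ q → mapExp h (-P q) ≡ -P (mapExp h q)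
    map-neg [] = refl
    map-neg (t ∷ q) = cong (_ ∷_) (map-neg q)

  HasExp : ∀ {m} → Mon m → Term m → Set
  HasExp β t = proj₂ t ≡ β

  HasExp? : ∀ {m} (β : Mon m) → Decidable (HasExp β)
  HasExp? β t = ≡-dec ℕ._≟_ (proj₂ t) β

  coeffSum : ∀ {m} → Poly m → Carrier
  coeffSum [] = 0#
  coeffSum ((a , _) ∷ p) = a + coeffSum p

  coeff-monomial : ∀ {m} {β : Mon m} q → All (HasExp β) q → coeff q β ≈ coeffSum q
  coeff-monomial [] [] = ≈-refl
  coeff-monomial ((a , β) ∷ q) (refl ∷ s) with ≡-dec ℕ._≟_ β β
  ... | yes _ = +-congˡ (coeff-monomial q s)
  ... | no β≢β = ⊥-elim (β≢β refl)

  coeff-monomial-other : ∀ {m} {β α : Mon m} q → All (HasExp β) q → β ≢ α → coeff q α ≈ 0#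
  coeff-monomial-other [] [] _ = ≈-refl
  coeff-monomial-other {α = α} ((a , β) ∷ q) (refl ∷ s) β≢α with ≡-dec ℕ._≟_ β α
  ... | yes β≡α = ⊥-elim (β≢α β≡α)
  ... | no _ = coeff-monomial-other q s β≢α

  coeff-missing : ∀ {m} {β : Mon m} q → All (¬_ ∘ HasExp β) q → coeff q β ≈ 0#
  coeff-missing [] [] = ≈-refl
  coeff-missing {β = β} ((a , β') ∷ q) (β'≢β ∷ s) with ≡-dec ℕ._≟_ β' β
  ... | yes β'≡β = ⊥-elim (β'≢β β'≡β)
  ... | no _ = coeff-missing q s

  module _ {m} (β : Mon m) (p : Poly m) (p≈0 : IsZero p) where
    private
      same = filter (HasExp? β) p
      rest = filter (¬? ∘ HasExp? β) p
      same-β = AllP.all-filter (HasExp? β) p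
      rest-β = AllP.all-filter (¬? ∘ HasExp? β) p

    rest-zero : IsZero rest
    rest-zero α with ≡-dec ℕ._≟_ β α
    ... | yes refl = coeff-missing rest rest-β
    ... | no β≢α = begin
      coeff rest α                 ≈⟨ +-identityˡ _ ⟨
      0# + coeff rest α            ≈⟨ +-congʳ (coeff-monomial-other same same-β β≢α) ⟨
      coeff same α + coeff rest α  ≈⟨ coeff-split (HasExp? β) p α ⟨
      coeff p α                    ≈⟨ p≈0 α ⟩
      0#                           ∎

    same-sum-zero : coeffSum same ≈ 0#
    same-sum-zero = begin
      coeffSum same                ≈⟨ coeff-monomial same same-β ⟨
      coeff same β                 ≈⟨ +-identityʳ _ ⟨
      coeff same β + 0#            ≈⟨ +-congˡ (rest-zero β) ⟨
      coeff same β + coeff rest β  ≈⟨ coeff-split (HasExp? β) p β ⟨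
      coeff p β                    ≈⟨ p≈0 β ⟩
      0#                           ∎

  mapExp-HasExp : ∀ {m m'} {β : Mon m} (h : Mon m → Mon m') q → All (HasExp β) q → All (HasExp (h β)) (mapExp h q)
  mapExp-HasExp h [] [] = []
  mapExp-HasExp h (t ∷ q) (refl ∷ s) = refl ∷ mapExp-HasExp h q s

  coeffSum-mapExp : ∀ {m m'} (h : Mon m → Mon m') q → coeffSum (mapExp h q) ≡ coeffSum q
  coeffSum-mapExp h [] = refl
  coeffSum-mapExp h ((a , _) ∷ q) = cong (a +_) (coeffSum-mapExp h q)

  mapExp-monomial-zero : ∀ {m m'} {β : Mon m} (h : Mon m → Mon m') q → All (HasExp β) q →
                         coeffSum q ≈ 0# → IsZero (mapExp h q)
  mapExp-monomial-zero {β = β} h q q-β sum≈0 α with ≡-dec ℕ._≟_ (h β) α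
  ... | yes refl = begin
    coeff (mapExp h q) (h β)  ≈⟨ coeff-monomial (mapExp h q) (mapExp-HasExp h q q-β) ⟩
    coeffSum (mapExp h q)     ≡⟨ coeffSum-mapExp h q ⟩
    coeffSum q                ≈⟨ sum≈0 ⟩
    0#                        ∎
  ... | no hβ≢α = coeff-monomial-other (mapExp h q) (mapExp-HasExp h q q-β) hβ≢α

  -- Renaming exponents preserves zero polynomials (group the terms by exponent:
  -- each group has zero coefficient sum, and is renamed to a single exponent).
  mapExp-zero : ∀ {m m'} (h : Mon m → Mon m') (p : Poly m) → IsZero p → IsZero (mapExp h p)
  mapExp-zero h p = by-length (length p) p ℕP.≤-refl
    where
    by-length : ∀ n p → length p ≤ n → IsZero p → IsZero (mapExp h p)
    by-length _ [] _ _ α = ≈-refl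
    by-length (suc n) ((a , β) ∷ p) (ℕ.s≤s len) p₀≈0 α = begin
      coeff (mapExp h p₀) α                               ≈⟨ coeff-mapExp-split (HasExp? β) h p₀ α ⟩
      coeff (mapExp h same) α + coeff (mapExp h rest) α   ≈⟨ +-cong same↦0 rest↦0 ⟩
      0# + 0#                                             ≈⟨ +-identityˡ 0# ⟩
      0#                                                  ∎
      where
      p₀ = (a , β) ∷ p
      same = filter (HasExp? β) p₀
      rest = filter (¬? ∘ HasExp? β) p₀
      rest-length : length rest ≤ n
      rest-length rewrite ListP.filter-reject (¬? ∘ HasExp? β) {x = a , β} {xs = p} (λ β≢β → β≢β refl) =
        ℕP.≤-trans (ListP.length-filter (¬? ∘ HasExp? β) p) len
      same↦0 = mapExp-monomial-zero h same (AllP.all-filter (HasExp? β) p₀) (same-sum-zero β p₀ p₀≈0) α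
      rest↦0 = by-length n rest rest-length (rest-zero β p₀ p₀≈0) α

  mapExp-resp : ∀ {m m'} (h : Mon m → Mon m') {p q : Poly m} → p ≈P q → mapExp h p ≈P mapExp h q
  mapExp-resp h {p} {q} p≈q =
    zero-⊝ {p = mapExp h p} {mapExp h q}
      (≡.subst IsZero (mapExp-⊝ h p q) (mapExp-zero h (p ⊝ q) (⊝-zero {p = p} {q} p≈q)))

-- An element of the ideal ⟨G⟩ is, up to
-- equality of polynomials, a finite sum of monomial multiples
-- a·z^α·(z^u − z^v) of generators z^u − z^v ∈ G; working with such
-- "multiples" instead of arbitrary polynomial coefficients makes the
-- closure properties of the ideal easy to prove.

module Ideals {c ℓ} (K : Field c ℓ) where
  open Field K renaming (refl to ≈-refl; sym to ≈-sym; trans to ≈-trans)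
  open PolyRing K
  open Exponents K
  open Coefficients K
  open import Algebra.Properties.Ring ring using (-‿distribʳ-*; -1*x≈-x)
  open import Relation.Binary.Reasoning.Setoid setoid

  -- a·z^α·(z^u − z^v), represented by (a , α , (u , v))
  Multiple : ℕ → Set c
  Multiple m = Carrier × Mon m × Binom m

  generator : ∀ {m} → Multiple m → Binom m
  generator (_ , _ , b) = b

  expand : ∀ {m} → List (Multiple m) → Poly m
  expand [] = []
  expand ((a , α , (u , v)) ∷ ms) = (a , α ⊕ expOf u) ∷ (- a , α ⊕ expOf v) ∷ expand ms

  Generated : ∀ {m f} → (Binom m → Set f) → Poly m → Set (c ⊔ ℓ ⊔ f)
  Generated G p = ∃[ ms ] (All (G ∘ generator) ms × p ≈P expand ms)

  expand-++ : ∀ {m} (ms ns : List (Multiple m)) → expand (ms ++ ns) ≡ expand ms ++ expand ns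
  expand-++ [] ns = refl
  expand-++ ((a , α , (u , v)) ∷ ms) ns = cong (λ p → _ ∷ _ ∷ p) (expand-++ ms ns)

  a*-1≈-a : ∀ a → a * - 1# ≈ - a
  a*-1≈-a a = ≈-trans (*-comm a (- 1#)) (-1*x≈-x a)

  shift : ∀ {m} → Carrier → Mon m → Poly m → Poly m
  shift a γ p = scale a (mapExp (γ ⊕_) p)

  shift-resp : ∀ {m} a (γ : Mon m) {p q : Poly m} → p ≈P q → shift a γ p ≈P shift a γ q
  shift-resp a γ {p} {q} p≈q α = begin
    coeff (shift a γ p) α             ≈⟨ coeff-scale a (mapExp (γ ⊕_) p) α ⟩
    a * coeff (mapExp (γ ⊕_) p) α     ≈⟨ *-congˡ (mapExp-resp (γ ⊕_) {p} {q} p≈q α) ⟩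
    a * coeff (mapExp (γ ⊕_) q) α     ≈⟨ coeff-scale a (mapExp (γ ⊕_) q) α ⟨
    coeff (shift a γ q) α             ∎

  shiftMultiple : ∀ {m} → Carrier → Mon m → Multiple m → Multiple m
  shiftMultiple a γ (b , β , g) = (a * b , γ ⊕ β , g)

  shift-expand : ∀ {m} a (γ : Mon m) ms → shift a γ (expand ms) ≐ expand (List.map (shiftMultiple a γ) ms)
  shift-expand a γ [] = []
  shift-expand a γ ((b , β , (u , v)) ∷ ms) =
    term ≈-refl (≡.sym (⊕-assoc γ β (expOf u)))
      (term (≈-sym (-‿distribʳ-* a b)) (≡.sym (⊕-assoc γ β (expOf v))) (shift-expand a γ ms))

  negMultiple : ∀ {m} → Multiple m → Multiple m
  negMultiple (a , α , g) = (- a , α , g)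

  neg-expand : ∀ {m} (ms : List (Multiple m)) → -P (expand ms) ≡ expand (List.map negMultiple ms)
  neg-expand [] = refl
  neg-expand ((a , α , (u , v)) ∷ ms) = cong (λ p → _ ∷ _ ∷ p) (neg-expand ms)

  module _ {m f} {G : Binom m → Set f} where
    Generated-resp : ∀ {p q} → p ≈P q → Generated G q → Generated G p
    Generated-resp p≈q (ms , ms∈G , q≈ms) = ms , ms∈G , λ α → ≈-trans (p≈q α) (q≈ms α)

    Generated-zero : ∀ {p} → IsZero p → Generated G p
    Generated-zero p≈0 = [] , [] , p≈0

    Generated-++ : ∀ {p q} → Generated G p → Generated G q → Generated G (p ++ q)
    Generated-++ {p} {q} (ms , ms∈G , p≈ms) (ns , ns∈G , q≈ns) =
      ms ++ ns , AllP.++⁺ ms∈G ns∈G , λ α → begin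
        coeff (p ++ q) α                            ≈⟨ coeff-++ p q α ⟩
        coeff p α + coeff q α                       ≈⟨ +-cong (p≈ms α) (q≈ns α) ⟩
        coeff (expand ms) α + coeff (expand ns) α   ≈⟨ coeff-++ (expand ms) (expand ns) α ⟨
        coeff (expand ms ++ expand ns) α            ≡⟨ cong (λ r → coeff r α) (expand-++ ms ns) ⟨
        coeff (expand (ms ++ ns)) α                 ∎

    Generated-shift : ∀ a γ {p} → Generated G p → Generated G (shift a γ p)
    Generated-shift a γ {p} (ms , ms∈G , p≈ms) =
      List.map (shiftMultiple a γ) ms , AllP.map⁺ (kept ms ms∈G) ,
      λ α → ≈-trans (shift-resp a γ {p} {expand ms} p≈ms α) (≐⇒≈P (shift-expand a γ ms) α)
      where
      kept : ∀ ms → All (G ∘ generator) ms → All (G ∘ generator ∘ shiftMultiple a γ) ms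
      kept [] [] = []
      kept ((_ , _ , _) ∷ ms) (g ∷ gs) = g ∷ kept ms gs

    Generated-neg : ∀ {p} → Generated G p → Generated G (-P p)
    Generated-neg {p} (ms , ms∈G , p≈ms) =
      List.map negMultiple ms , AllP.map⁺ (kept ms ms∈G) , λ α → begin
        coeff (-P p) α                               ≈⟨ coeff-neg p α ⟩
        - coeff p α                                  ≈⟨ -‿cong (p≈ms α) ⟩
        - coeff (expand ms) α                        ≈⟨ coeff-neg (expand ms) α ⟨
        coeff (-P expand ms) α                       ≡⟨ cong (λ r → coeff r α) (neg-expand ms) ⟩
        coeff (expand (List.map negMultiple ms)) α   ∎
      where
      kept : ∀ ms → All (G ∘ generator) ms → All (G ∘ generator ∘ negMultiple) ms
      kept [] [] = []
      kept ((_ , _ , _) ∷ ms) (g ∷ gs) = g ∷ kept ms gs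

    Generated-generator : ∀ {b} → G b → Generated G ⟦ b ⟧
    Generated-generator {u , v} g =
      (1# , 0⃗ , (u , v)) ∷ [] , g ∷ [] ,
      ≐⇒≈P (term ≈-refl (≡.sym (⊕-identityˡ _)) (term ≈-refl (≡.sym (⊕-identityˡ _)) []))

  -- Generated agrees with the ideal membership InIdeal of the statement:
  -- a polynomial multiple g·(z^u − z^v) is the sum of the monomial multiples
  -- given by the terms of g.
  module _ {m f} (G : Binom m → Set f) where
    private
      termMultiples : Binom m → Poly m → List (Multiple m)
      termMultiples b = List.map (λ t → proj₁ t , proj₂ t , b)

      multiples : List (Poly m × Binom m) → List (Multiple m)
      multiples [] = []
      multiples ((g , b) ∷ gs) = termMultiples b g ++ multiples gs

      combination : List (Poly m × Binom m) → Poly m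
      combination gs = sumP (List.map (λ { (g , b) → g *P ⟦ b ⟧ }) gs)

      product-expand : ∀ g b → (g *P ⟦ b ⟧) ≐ expand (termMultiples b g)
      product-expand [] b = []
      product-expand ((a , α) ∷ g) (u , v) =
        term (*-identityʳ a) refl (term (a*-1≈-a a) refl (product-expand g (u , v)))

      combination-expand : ∀ gs → combination gs ≐ expand (multiples gs)
      combination-expand [] = []
      combination-expand ((g , b) ∷ gs) rewrite expand-++ (termMultiples b g) (multiples gs) =
        ≐-++ (product-expand g b) (combination-expand gs)

      asProducts : List (Multiple m) → List (Poly m × Binom m)
      asProducts [] = []
      asProducts ((a , α , b) ∷ ms) = ((a , α) ∷ [] , b) ∷ asProducts ms

      expand-combination : ∀ ms → expand ms ≐ combination (asProducts ms)
      expand-combination [] = []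
      expand-combination ((a , α , (u , v)) ∷ ms) =
        term (≈-sym (*-identityʳ a)) refl (term (≈-sym (a*-1≈-a a)) refl (expand-combination ms))

    InIdeal⇒Generated : ∀ {p} → InIdeal G p → Generated G p
    InIdeal⇒Generated (gs , gs∈G , p≈gs) =
      multiples gs , kept gs gs∈G , λ α → ≈-trans (p≈gs α) (≐⇒≈P (combination-expand gs) α)
      where
      kept : ∀ gs → All (G ∘ proj₂) gs → All (G ∘ generator) (multiples gs)
      kept [] [] = []
      kept ((g , b) ∷ gs) (b∈G ∷ gs∈G) = AllP.++⁺ (AllP.map⁺ (All.tabulate λ _ → b∈G)) (kept gs gs∈G)

    Generated⇒InIdeal : ∀ {p} → Generated G p → InIdeal G p
    Generated⇒InIdeal (ms , ms∈G , p≈ms) =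
      asProducts ms , kept ms ms∈G , λ α → ≈-trans (p≈ms α) (≐⇒≈P (expand-combination ms) α)
      where
      kept : ∀ ms → All (G ∘ generator) ms → All (G ∘ proj₂) (asProducts ms)
      kept [] [] = []
      kept ((_ , _ , _) ∷ ms) (b∈G ∷ ms∈G) = b∈G ∷ kept ms ms∈G

module Congruence {c ℓ f} (K : Field c ℓ) {m} (G : PolyRing.Binom K m → Set f) where
  open Field K renaming (refl to ≈-refl; sym to ≈-sym; trans to ≈-trans)
  open PolyRing K
  open Exponents K
  open Coefficients K
  open Ideals K
  open import Algebra.Properties.AbelianGroup +-abelianGroup using (⁻¹-anti-homo‿-)
  open import Algebra.Properties.CommutativeSemigroup +-commutativeSemigroup using (x∙yz≈y∙xz)
  open import Relation.Binary.Reasoning.Setoid setoid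

  binomial : Mon m → Mon m → Poly m
  binomial β β' = (1# , β) ∷ (- 1# , β') ∷ []

  monomial : Mon m → Poly m
  monomial β = (1# , β) ∷ []

  coeff-binomial : ∀ β β' α → coeff (binomial β β') α ≈ coeff (monomial β) α + - coeff (monomial β') α
  coeff-binomial β β' α = coeff-⊝ (monomial β) (monomial β') α

  record _~_ (β β' : Mon m) : Set (c ⊔ ℓ ⊔ f) where
    constructor ~-intro
    field ~-elim : Generated G (binomial β β')
  open _~_ public

  ~-refl : ∀ {β} → β ~ β
  ~-refl {β} = ~-intro (Generated-zero {p = binomial β β} (λ α → ≈-trans (coeff-binomial β β α) (-‿inverseʳ _)))

  ~-reflexive : ∀ {β β'} → β ≡ β' → β ~ β'
  ~-reflexive refl = ~-refl

  -- z^β' − z^β = −(z^β − z^β')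
  ~-sym : ∀ {β β'} → β ~ β' → β' ~ β
  ~-sym {β} {β'} (~-intro β~β') = ~-intro (Generated-resp {p = binomial β' β} {q = -P binomial β β'}
    (λ α → let x = coeff (monomial β) α ; y = coeff (monomial β') α in begin
      coeff (binomial β' β) α   ≈⟨ coeff-binomial β' β α ⟩
      y + - x                   ≈⟨ ⁻¹-anti-homo‿- x y ⟨
      - (x + - y)               ≈⟨ -‿cong (coeff-binomial β β' α) ⟨
      - coeff (binomial β β') α ≈⟨ coeff-neg (binomial β β') α ⟨
      coeff (-P binomial β β') α ∎)
    (Generated-neg {p = binomial β β'} β~β'))

  -- z^β − z^β'' = (z^β − z^β') + (z^β' − z^β'')
  ~-trans : ∀ {β β' β''} → β ~ β' → β' ~ β'' → β ~ β''
  ~-trans {β} {β'} {β''} (~-intro β~β') (~-intro β'~β'') =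
    ~-intro (Generated-resp {p = binomial β β''} {q = binomial β β' ++ binomial β' β''}
      (λ α → let x = coeff (monomial β) α ; y = coeff (monomial β') α ; z = coeff (monomial β'') α in begin
        coeff (binomial β β'') α                              ≈⟨ coeff-binomial β β'' α ⟩
        x + - z                                               ≈⟨ +-congˡ (+-identityˡ _) ⟨
        x + (0# + - z)                                        ≈⟨ +-congˡ (+-congʳ (-‿inverseˡ y)) ⟨
        x + ((- y + y) + - z)                                 ≈⟨ +-congˡ (+-assoc (- y) y (- z)) ⟩
        x + (- y + (y + - z))                                 ≈⟨ +-assoc x (- y) _ ⟨
        (x + - y) + (y + - z)                                 ≈⟨ +-cong (coeff-binomial β β' α) (coeff-binomial β' β'' α) ⟨
        coeff (binomial β β') α + coeff (binomial β' β'') α   ≈⟨ coeff-++ (binomial β β') (binomial β' β'') α ⟨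
        coeff (binomial β β' ++ binomial β' β'') α            ∎)
      (Generated-++ {p = binomial β β'} {q = binomial β' β''} β~β' β'~β''))

  -- z^γ·(z^β − z^β') = z^{γ+β} − z^{γ+β'}
  ~-cong : ∀ γ {β β'} → β ~ β' → (γ ⊕ β) ~ (γ ⊕ β')
  ~-cong γ {β} {β'} (~-intro β~β') =
    ~-intro (Generated-resp {p = binomial (γ ⊕ β) (γ ⊕ β')} {q = shift 1# γ (binomial β β')}
      (≐⇒≈P {p = binomial (γ ⊕ β) (γ ⊕ β')} {q = shift 1# γ (binomial β β')}
        (term (≈-sym (*-identityˡ 1#)) refl (term (≈-sym (*-identityˡ _)) refl [])))
      (Generated-shift 1# γ {binomial β β'} β~β'))

  ~-scaled : ∀ a {β β'} → β ~ β' → Generated G ((a , β) ∷ (- a , β') ∷ [])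
  ~-scaled a {β} {β'} (~-intro β~β') =
    Generated-resp {p = (a , β) ∷ (- a , β') ∷ []} {q = shift a 0⃗ (binomial β β')}
      (≐⇒≈P {p = (a , β) ∷ (- a , β') ∷ []} {q = shift a 0⃗ (binomial β β')}
        (term (≈-sym (*-identityʳ a)) (≡.sym (⊕-identityˡ β))
              (term (≈-sym (a*-1≈-a a)) (≡.sym (⊕-identityˡ β')) [])))
      (Generated-shift a 0⃗ {binomial β β'} β~β')

  -- P − Λ(P) ∈ ⟨G⟩ whenever every exponent α of P satisfies α ~ Λ α
  -- (P − Λ(P) is the sum of the a·z^α − a·z^{Λ α} over the terms of P).
  minus-congruent : ∀ (Λ : Mon m → Mon m) P → All (λ t → proj₂ t ~ Λ (proj₂ t)) P → Generated G (P ⊝ mapExp Λ P)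
  minus-congruent Λ [] [] = Generated-zero {p = []} (λ α → ≈-refl)
  minus-congruent Λ ((a , α) ∷ P) (α~Λα ∷ rest) =
    Generated-resp {p = ((a , α) ∷ P) ⊝ mapExp Λ ((a , α) ∷ P)} {q = pair ++ (P ⊝ mapExp Λ P)} regroup
      (Generated-++ {p = pair} {q = P ⊝ mapExp Λ P} (~-scaled a α~Λα) (minus-congruent Λ P rest))
    where
    X = (a , α) ∷ []
    Y = (- a , Λ α) ∷ []
    R = -P mapExp Λ P
    pair = X ++ Y
    regroup : ((X ++ P) ++ (Y ++ R)) ≈P ((X ++ Y) ++ (P ++ R))
    regroup β = begin
      coeff (X ++ (P ++ (Y ++ R))) β                       ≈⟨ coeff-++ X _ β ⟩
      coeff X β + coeff (P ++ (Y ++ R)) β                  ≈⟨ +-congˡ (≈-trans (coeff-++ P _ β) (+-congˡ (coeff-++ Y R β))) ⟩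
      coeff X β + (coeff P β + (coeff Y β + coeff R β))    ≈⟨ +-congˡ (x∙yz≈y∙xz _ _ _) ⟩
      coeff X β + (coeff Y β + (coeff P β + coeff R β))    ≈⟨ +-assoc _ _ _ ⟨
      (coeff X β + coeff Y β) + (coeff P β + coeff R β)    ≈⟨ +-cong (coeff-++ X Y β) (coeff-++ P R β) ⟨
      coeff (X ++ Y) β + coeff (P ++ R) β                  ≈⟨ coeff-++ (X ++ Y) (P ++ R) β ⟨
      coeff ((X ++ Y) ++ (P ++ R)) β                       ∎

  record _≈ᶠ_ (u w : List (Fin m)) : Set (c ⊔ ℓ ⊔ f) where
    constructor ≈ᶠ-intro
    field ≈ᶠ-elim : expOf u ~ expOf w
  open _≈ᶠ_ public

  ≈ᶠ-refl : ∀ {u} → u ≈ᶠ u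
  ≈ᶠ-refl = ≈ᶠ-intro ~-refl

  ≈ᶠ-sym : ∀ {u w} → u ≈ᶠ w → w ≈ᶠ u
  ≈ᶠ-sym (≈ᶠ-intro r) = ≈ᶠ-intro (~-sym r)

  ≈ᶠ-trans : ∀ {u w z} → u ≈ᶠ w → w ≈ᶠ z → u ≈ᶠ z
  ≈ᶠ-trans (≈ᶠ-intro r) (≈ᶠ-intro r') = ≈ᶠ-intro (~-trans r r')

  ≈ᶠ-generator : ∀ {u w} → G (u , w) → u ≈ᶠ w
  ≈ᶠ-generator g = ≈ᶠ-intro (~-intro (Generated-generator g))

  ↭⇒≈ᶠ : ∀ {u w} → u ↭ w → u ≈ᶠ w
  ↭⇒≈ᶠ p = ≈ᶠ-intro (~-reflexive (expOf-↭ p))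

  ≈ᶠ-swap : ∀ x y u → (x ∷ y ∷ u) ≈ᶠ (y ∷ x ∷ u)
  ≈ᶠ-swap x y u = ↭⇒≈ᶠ (Perm.swap x y Perm.refl)

  ≈ᶠ-prefix : ∀ t {u w} → u ≈ᶠ w → (t ++ u) ≈ᶠ (t ++ w)
  ≈ᶠ-prefix t {u} {w} (≈ᶠ-intro r) =
    ≈ᶠ-intro (≡.subst₂ _~_ (≡.sym (expOf-++ t u)) (≡.sym (expOf-++ t w)) (~-cong (expOf t) r))

  ≈ᶠ-∷ : ∀ x {u w} → u ≈ᶠ w → (x ∷ u) ≈ᶠ (x ∷ w)
  ≈ᶠ-∷ x = ≈ᶠ-prefix (x ∷ [])

  ≈ᶠ-suffix : ∀ t {u w} → u ≈ᶠ w → (u ++ t) ≈ᶠ (w ++ t)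
  ≈ᶠ-suffix t {u} {w} r =
    ≈ᶠ-trans (↭⇒≈ᶠ (PermP.++-comm u t)) (≈ᶠ-trans (≈ᶠ-prefix t r) (↭⇒≈ᶠ (PermP.++-comm t w)))

module MonomialMaps {c ℓ} (K : Field c ℓ) where
  open Field K renaming (refl to ≈-refl; sym to ≈-sym; trans to ≈-trans)
  open PolyRing K
  open Exponents K
  open Coefficients K
  open Ideals K
  open import Relation.Binary.Reasoning.Setoid setoid

  monoMap≡mapExp : ∀ {m k} (img : Fin m → Mon k) p → monoMap img p ≡ mapExp (expImage img) p
  monoMap≡mapExp img [] = refl
  monoMap≡mapExp img (t ∷ p) = cong (_ ∷_) (monoMap≡mapExp img p)

  Balanced : ∀ {m k} → (Fin m → Mon k) → Binom m → Set
  Balanced img (u , v) = expImage img (expOf u) ≡ expImage img (expOf v)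

  generated-in-kernel : ∀ {m k f} {G : Binom m → Set f} (img : Fin m → Mon k) →
    (∀ b → G b → Balanced img b) → ∀ {p} → Generated G p → IsZero (monoMap img p)
  generated-in-kernel {G = G} img balanced {p} (ms , ms∈G , p≈ms) α = begin
    coeff (monoMap img p) α        ≡⟨ cong (λ q → coeff q α) (monoMap≡mapExp img p) ⟩
    coeff (mapExp h p) α           ≈⟨ mapExp-resp h {p} {expand ms} p≈ms α ⟩
    coeff (mapExp h (expand ms)) α ≈⟨ multiples-vanish ms ms∈G α ⟩
    0#                             ∎
    where
    h = expImage img
    -- h(α + u) = h α + h u = h α + h v = h(α + v) for a balanced generator (u , v)
    multiples-vanish : ∀ ms → All (G ∘ generator) ms → IsZero (mapExp h (expand ms))
    multiples-vanish [] [] α = ≈-refl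
    multiples-vanish ((a , β , (u , v)) ∷ ms) (g ∷ gs) α = begin
      coeff (pair ++ mapExp h (expand ms)) α          ≈⟨ coeff-++ pair (mapExp h (expand ms)) α ⟩
      coeff pair α + coeff (mapExp h (expand ms)) α   ≈⟨ +-cong (pair-vanishes images-agree α) (multiples-vanish ms gs α) ⟩
      0# + 0#                                         ≈⟨ +-identityˡ 0# ⟩
      0#                                              ∎
      where
      pair = (a , h (β ⊕ expOf u)) ∷ (- a , h (β ⊕ expOf v)) ∷ []
      images-agree : h (β ⊕ expOf u) ≡ h (β ⊕ expOf v)
      images-agree = ≡.trans (expImage-⊕ img β (expOf u))
        (≡.trans (cong (h β ⊕_) (balanced (u , v) g)) (≡.sym (expImage-⊕ img β (expOf v))))
      pair-vanishes : ∀ {γ γ'} → γ ≡ γ' → IsZero ((a , γ) ∷ (- a , γ') ∷ [])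
      pair-vanishes {γ} refl = ⊝-zero {p = (a , γ) ∷ []} {q = (a , γ) ∷ []} (λ _ → ≈-refl)

  ideal-in-kernel : ∀ {m k f} {G : Binom m → Set f} (img : Fin m → Mon k) →
    (∀ b → G b → Balanced img b) → ∀ {p} → InIdeal G p → monoMap img p ≈P 0P
  ideal-in-kernel {G = G} img balanced {p} p∈G = generated-in-kernel img balanced {p} (InIdeal⇒Generated G {p} p∈G)

  -- If z^u − z^v is in the kernel then u, v have the same image: otherwise the
  -- coefficient of y^{h u} in the image would be 1 ≠ 0.
  kernel-binomial-balanced : ∀ {m k} (img : Fin m → Mon k) u v →
    monoMap img ⟦ u , v ⟧ ≈P 0P → Balanced img (u , v)
  kernel-binomial-balanced img u v u-v↦0 = by-cases (≡-dec ℕ._≟_ hv hu)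
    where
    hu = expImage img (expOf u)
    hv = expImage img (expOf v)
    by-cases : Dec (hv ≡ hu) → hu ≡ hv
    by-cases (yes hv≡hu) = ≡.sym hv≡hu
    by-cases (no hv≢hu) = ⊥-elim (0≉1 (≈-sym (begin
      1#                                       ≈⟨ +-identityʳ 1# ⟨
      1# + 0#                                  ≈⟨ +-cong (≈-sym (≈-trans (coeff-monomial ((1# , hu) ∷ []) (refl ∷ [])) (+-identityʳ 1#)))
                                                         (≈-sym (coeff-monomial-other ((- 1# , hv) ∷ []) (refl ∷ []) hv≢hu)) ⟩
      coeff ((1# , hu) ∷ []) hu + coeff ((- 1# , hv) ∷ []) hu  ≈⟨ coeff-++ ((1# , hu) ∷ []) ((- 1# , hv) ∷ []) hu ⟨
      coeff (monoMap img ⟦ u , v ⟧) hu         ≈⟨ u-v↦0 hu ⟩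
      0#                                       ∎)))

  -- Let deg grade the target exponents.  If
  -- every kernel polynomial all of whose terms have the same degree lies in
  -- ⟨G⟩, then so does every kernel polynomial: its part of any degree d is
  -- again in the kernel, as renaming along h keeps the degrees of terms apart.
  kernel-by-degree : ∀ {m k f} {G : Binom m → Set f} (h : Mon m → Mon k) (deg : Mon k → ℕ) →
    (∀ d P → All (λ t → deg (h (proj₂ t)) ≡ d) P → IsZero (mapExp h P) → Generated G P) →
    ∀ p → IsZero (mapExp h p) → Generated G p
  kernel-by-degree {m} {G = G} h deg homogeneous p = by-length (length p) p ℕP.≤-refl
    where
    OfDegree : ℕ → Term m → Set
    OfDegree d t = deg (h (proj₂ t)) ≡ d

    OfDegree? : ∀ d → Decidable (OfDegree d)
    OfDegree? d t = deg (h (proj₂ t)) ℕ.≟ d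

    absent : ∀ {Q : Term m → Set} γ q → All Q q → (∀ {t} → Q t → h (proj₂ t) ≢ γ) → coeff (mapExp h q) γ ≈ 0#
    absent γ q all-Q Q⇒≢γ = coeff-missing (mapExp h q) (AllP.map⁺ (All.map Q⇒≢γ all-Q))

    part rest : ℕ → Poly m → Poly m
    part d = filter (OfDegree? d)
    rest d = filter (¬? ∘ OfDegree? d)

    module _ (d : ℕ) (q : Poly m) (q↦0 : IsZero (mapExp h q)) where

      part-rest : ∀ γ → coeff (mapExp h (part d q)) γ + coeff (mapExp h (rest d q)) γ ≈ 0#
      part-rest γ = ≈-trans (≈-sym (coeff-mapExp-split (OfDegree? d) h q γ)) (q↦0 γ)

      part↦0 : IsZero (mapExp h (part d q))
      part↦0 γ with deg γ ℕ.≟ d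
      ... | yes deg-γ≡d = begin
        coeff (mapExp h (part d q)) γ                               ≈⟨ +-identityʳ _ ⟨
        coeff (mapExp h (part d q)) γ + 0#                          ≈⟨ +-congˡ (absent γ (rest d q) (AllP.all-filter (¬? ∘ OfDegree? d) q)
                                                                  (λ deg≢d hα≡γ → deg≢d (≡.trans (cong deg hα≡γ) deg-γ≡d))) ⟨
        coeff (mapExp h (part d q)) γ + coeff (mapExp h (rest d q)) γ     ≈⟨ part-rest γ ⟩
        0#                                                    ∎
      ... | no deg-γ≢d = absent γ (part d q) (AllP.all-filter (OfDegree? d) q)
                            (λ deg≡d hα≡γ → deg-γ≢d (≡.trans (cong deg (≡.sym hα≡γ)) deg≡d))

      rest↦0 : IsZero (mapExp h (rest d q))
      rest↦0 γ = begin
        coeff (mapExp h (rest d q)) γ                               ≈⟨ +-identityˡ _ ⟨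
        0# + coeff (mapExp h (rest d q)) γ                          ≈⟨ +-congʳ (part↦0 γ) ⟨
        coeff (mapExp h (part d q)) γ + coeff (mapExp h (rest d q)) γ     ≈⟨ part-rest γ ⟩
        0#                                                    ∎

    by-length : ∀ n p → length p ≤ n → IsZero (mapExp h p) → Generated G p
    by-length _ [] _ _ = Generated-zero {p = []} (λ α → ≈-refl)
    by-length (suc n) ((a , α) ∷ p) (ℕ.s≤s len) p₀↦0 =
      Generated-resp {p = p₀} {q = part d p₀ ++ rest d p₀}
        (λ β → ≈-trans (coeff-split (OfDegree? d) p₀ β) (≈-sym (coeff-++ (part d p₀) (rest d p₀) β)))
        (Generated-++ {p = part d p₀} {q = rest d p₀}
          (homogeneous d (part d p₀) (AllP.all-filter (OfDegree? d) p₀) (part↦0 d p₀ p₀↦0))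
          (by-length n (rest d p₀) rest-length (rest↦0 d p₀ p₀↦0)))
      where
      p₀ = (a , α) ∷ p
      d = deg (h α)
      rest-length : length (rest d p₀) ≤ n
      rest-length rewrite ListP.filter-reject (¬? ∘ OfDegree? d) {x = a , α} {xs = p} (λ d≢d → d≢d refl) =
        ℕP.≤-trans (ListP.length-filter (¬? ∘ OfDegree? d) p) len

-- The variables of
-- the big ring are x¹ⱼ (j ∈ [n]) and x²ⱼ (j ∈ [γ]); forgetting the
-- superscript sends both to x¹ⱼ, and the weight of a variable records its
-- superscript (the w-part of its π̃-image).

module Doubling {k ℓ f} (K : Field k ℓ) {d n γ : ℕ} (γ≤n : γ ≤ n)
                (B : Fin n → Subset d) (F : PolyRing.Binom K n → Set f) where
  open Field K renaming (refl to ≈-refl; sym to ≈-sym; trans to ≈-trans)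
  open PolyRing K
  open Exponents K
  open Coefficients K
  open Ideals K
  open MonomialMaps K
  open import Relation.Binary.Reasoning.Setoid setoid

  N : ℕ
  N = n ℕ.+ γ

  F̃ : Binom N → Set f
  F̃ = Ftilde γ γ≤n F

  π : Fin n → Mon d
  π = πImg B

  π̃ : Fin N → Mon (d ℕ.+ 2)
  π̃ = π̃Img B γ≤n

  X¹ : Fin n → Fin N
  X¹ = x¹

  X² : Fin γ → Fin N
  X² = x²

  two : Fin 2
  two = Fin.suc Fin.zero

  ι : Fin γ → Fin n
  ι j = inject≤ j γ≤n

  below : ∀ {j : Fin n} → toℕ j < γ → Fin γ
  below j<γ = fromℕ< j<γ

  ι<γ : ∀ j → toℕ (ι j) < γ
  ι<γ j rewrite FinP.toℕ-inject≤ j γ≤n = FinP.toℕ<n j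

  below-ι : ∀ j (p : toℕ (ι j) < γ) → below p ≡ j
  below-ι j p = FinP.toℕ-injective (≡.trans (FinP.toℕ-fromℕ< p) (FinP.toℕ-inject≤ j γ≤n))

  ι-below : ∀ (j : Fin n) (p : toℕ j < γ) → ι (below p) ≡ j
  ι-below j p = FinP.toℕ-injective (≡.trans (FinP.toℕ-inject≤ (fromℕ< p) γ≤n) (FinP.toℕ-fromℕ< p))

  forget : Fin N → Fin n
  forget x = [ (λ j → j) , ι ]′ (splitAt n x)

  weight : Fin N → Mon 2
  weight x = [ (λ _ → 1 ∷ 0 ∷ []) , (λ _ → 0 ∷ 1 ∷ []) ]′ (splitAt n x)

  π̃-split : ∀ x → π̃ x ≡ π (forget x) Vec.++ weight x
  π̃-split x with splitAt n x
  ... | inj₁ j = refl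
  ... | inj₂ j = refl

  data Variable : Fin N → Set where
    var¹ : ∀ j → Variable (X¹ j)
    var² : ∀ j → Variable (X² j)

  variable? : ∀ x → Variable x
  variable? x with splitAt n x in eq
  ... | inj₁ j rewrite ≡.sym (FinP.splitAt⁻¹-↑ˡ eq) = var¹ j
  ... | inj₂ j rewrite ≡.sym (FinP.splitAt⁻¹-↑ʳ eq) = var² j

  forget-X¹ : ∀ j → forget (X¹ j) ≡ j
  forget-X¹ j = cong [ (λ j → j) , ι ]′ (FinP.splitAt-↑ˡ n j γ)

  forget-X² : ∀ j → forget (X² j) ≡ ι j
  forget-X² j = cong [ (λ j → j) , ι ]′ (FinP.splitAt-↑ʳ n γ j)

  weight-X¹ : ∀ j → weight (X¹ j) ≡ 1 ∷ 0 ∷ []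
  weight-X¹ j = cong [ (λ _ → 1 ∷ 0 ∷ []) , (λ _ → 0 ∷ 1 ∷ []) ]′ (FinP.splitAt-↑ˡ n j γ)

  weight-X² : ∀ j → weight (X² j) ≡ 0 ∷ 1 ∷ []
  weight-X² j = cong [ (λ _ → 1 ∷ 0 ∷ []) , (λ _ → 0 ∷ 1 ∷ []) ]′ (FinP.splitAt-↑ʳ n γ j)

  -- Relabelling.  relabel I u gives the superscripts listed in I, in order,
  -- to the factors of u with index in [γ] (superscript 1 once I runs out);
  -- twos k lists k superscripts 2.
  relabel′ : List (Fin 2) → List (Fin n) → List (Fin N)
  relabel′ = relabel {n = n} {γ = γ}

  twos : ℕ → List (Fin 2)
  twos k = List.replicate k two

  Inside : Fin n → Set
  Inside j = toℕ j < γ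

  Inside? : Decidable Inside
  Inside? j = toℕ j <? γ

  countIn countOut : List (Fin n) → ℕ
  countIn u = countγ γ u
  countOut u = length (filter (¬? ∘ Inside?) u)

  countIn-in : ∀ {j} u → Inside j → countIn (j ∷ u) ≡ suc (countIn u)
  countIn-in u j-in = cong length (ListP.filter-accept Inside? j-in)

  countIn-out : ∀ {j} u → ¬ Inside j → countIn (j ∷ u) ≡ countIn u
  countIn-out u j-out = cong length (ListP.filter-reject Inside? j-out)

  countOut-in : ∀ {j} u → Inside j → countOut (j ∷ u) ≡ countOut u
  countOut-in u j-in = cong length (ListP.filter-reject (¬? ∘ Inside?) (λ j-out → j-out j-in))

  countOut-out : ∀ {j} u → ¬ Inside j → countOut (j ∷ u) ≡ suc (countOut u)
  countOut-out u j-out = cong length (ListP.filter-accept (¬? ∘ Inside?) j-out)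

  countIn+countOut : ∀ u → countIn u ℕ.+ countOut u ≡ length u
  countIn+countOut [] = refl
  countIn+countOut (j ∷ u) with Inside? j
  ... | yes j-in rewrite countIn-in u j-in | countOut-in u j-in = cong suc (countIn+countOut u)
  ... | no j-out rewrite countIn-out u j-out | countOut-out u j-out =
    ≡.trans (ℕP.+-suc _ _) (cong suc (countIn+countOut u))

  labelled : List (Fin 2) → (x : Fin n) → Inside x → Fin N
  labelled [] x _ = X¹ x
  labelled (Fin.zero ∷ _) x _ = X¹ x
  labelled (Fin.suc _ ∷ _) x x-in = X² (below x-in)

  relabel-in : ∀ I x w (x-in : Inside x) → relabel′ I (x ∷ w) ≡ labelled I x x-in ∷ relabel′ (List.drop 1 I) w
  relabel-in I x w x-in with Inside? x
  relabel-in [] x w x-in | yes _ = refl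
  relabel-in (Fin.zero ∷ I) x w x-in | yes _ = refl
  relabel-in (Fin.suc _ ∷ I) x w x-in | yes _ = refl
  ... | no x-out = ⊥-elim (x-out x-in)

  relabel-out : ∀ I x w → ¬ Inside x → relabel′ I (x ∷ w) ≡ X¹ x ∷ relabel′ I w
  relabel-out I x w x-out with Inside? x
  ... | yes x-in = ⊥-elim (x-out x-in)
  ... | no _ = refl

  forget-labelled : ∀ I x x-in → forget (labelled I x x-in) ≡ x
  forget-labelled [] x _ = forget-X¹ x
  forget-labelled (Fin.zero ∷ _) x _ = forget-X¹ x
  forget-labelled (Fin.suc _ ∷ _) x x-in = ≡.trans (forget-X² (below x-in)) (ι-below x x-in)

  forget-relabel : ∀ I u → List.map forget (relabel′ I u) ≡ u
  forget-relabel I [] = refl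
  forget-relabel I (j ∷ u) = by-cases (Inside? j)
    where
    by-cases : Dec (Inside j) → List.map forget (relabel′ I (j ∷ u)) ≡ j ∷ u
    by-cases (yes j-in) rewrite relabel-in I j u j-in =
      cong₂ _∷_ (forget-labelled I j j-in) (forget-relabel (List.drop 1 I) u)
    by-cases (no j-out) rewrite relabel-out I j u j-out = cong₂ _∷_ (forget-X¹ j) (forget-relabel I u)

  relabel-++ : ∀ I u w → relabel′ I (u ++ w) ≡ relabel′ I u ++ relabel′ (List.drop (countIn u) I) w
  relabel-++ I [] w = refl
  relabel-++ I (j ∷ u) w = by-cases (Inside? j)
    where
    by-cases : Dec (Inside j) → relabel′ I (j ∷ u ++ w) ≡ relabel′ I (j ∷ u) ++ relabel′ (List.drop (countIn (j ∷ u)) I) w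
    by-cases (yes j-in) rewrite relabel-in I j (u ++ w) j-in | relabel-in I j u j-in | countIn-in u j-in
                              | ≡.sym (ListP.drop-drop 1 (countIn u) I) =
      cong (labelled I j j-in ∷_) (relabel-++ (List.drop 1 I) u w)
    by-cases (no j-out) rewrite relabel-out I j (u ++ w) j-out | relabel-out I j u j-out | countIn-out u j-out =
      cong (X¹ j ∷_) (relabel-++ I u w)

  headLabel : List (Fin 2) → Fin 2
  headLabel [] = Fin.zero
  headLabel (i ∷ _) = i

  firstLabels : (c : ℕ) → List (Fin 2) → Vec (Fin 2) c
  firstLabels zero I = []
  firstLabels (suc c) I = headLabel I ∷ firstLabels c (List.drop 1 I)

  relabel-firstLabels : ∀ I u → relabel′ I u ≡ relabel′ (Vec.toList (firstLabels (countIn u) I)) u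
  relabel-firstLabels I [] = refl
  relabel-firstLabels I (j ∷ u) = by-cases (Inside? j)
    where
    labelled-head : ∀ I L x x-in → labelled (headLabel I ∷ L) x x-in ≡ labelled I x x-in
    labelled-head [] L x x-in = refl
    labelled-head (Fin.zero ∷ _) L x x-in = refl
    labelled-head (Fin.suc _ ∷ _) L x x-in = refl
    by-cases : Dec (Inside j) → relabel′ I (j ∷ u) ≡ relabel′ (Vec.toList (firstLabels (countIn (j ∷ u)) I)) (j ∷ u)
    by-cases (yes j-in)
      rewrite countIn-in u j-in | relabel-in I j u j-in
            | relabel-in (headLabel I ∷ Vec.toList (firstLabels (countIn u) (List.drop 1 I))) j u j-in
            | labelled-head I (Vec.toList (firstLabels (countIn u) (List.drop 1 I))) j j-in =
      cong (labelled I j j-in ∷_) (relabel-firstLabels (List.drop 1 I) u)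
    by-cases (no j-out)
      rewrite countIn-out u j-out | relabel-out I j u j-out | relabel-out (Vec.toList (firstLabels (countIn u) I)) j u j-out =
      cong (X¹ j ∷_) (relabel-firstLabels I u)

  drop-twos : ∀ c k → List.drop c (twos k) ≡ twos (k ∸ c)
  drop-twos zero k = refl
  drop-twos (suc c) zero = refl
  drop-twos (suc c) (suc k) = drop-twos c k

  twosHead : ℕ → Fin n → Fin N
  twosHead k x with Inside? x
  ... | no _ = X¹ x
  twosHead zero x | yes _ = X¹ x
  twosHead (suc k) x | yes x-in = X² (below x-in)

  twosLeft : ℕ → Fin n → ℕ
  twosLeft k x with Inside? x
  ... | yes _ = k ∸ 1
  ... | no _ = k

  relabel-twos-∷ : ∀ k x w → relabel′ (twos k) (x ∷ w) ≡ twosHead k x ∷ relabel′ (twos (twosLeft k x)) w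
  relabel-twos-∷ k x w with Inside? x
  ... | no _ = refl
  relabel-twos-∷ zero x w | yes _ = refl
  relabel-twos-∷ (suc k) x w | yes _ = refl

  twosLeft-comm : ∀ k x y → twosLeft (twosLeft k x) y ≡ twosLeft (twosLeft k y) x
  twosLeft-comm k x y with Inside? x | Inside? y
  ... | yes _ | yes _ = refl
  ... | yes _ | no _ = refl
  ... | no _ | yes _ = refl
  ... | no _ | no _ = refl

  open Congruence K F̃

  swap-binomial : ∀ (a b : Fin γ) → (X¹ (ι b) ∷ X² a ∷ []) ≈ᶠ (X¹ (ι a) ∷ X² b ∷ [])
  swap-binomial a b with FinP.<-cmp a b
  ... | tri< a<b _ _ = ≈ᶠ-generator (inj₂ (a , b , a<b , refl))
  ... | tri≈ _ refl _ = ≈ᶠ-refl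
  ... | tri> _ _ b<a = ≈ᶠ-sym (≈ᶠ-generator (inj₂ (b , a , b<a , refl)))

  move-two : ∀ {x y} (x-in : Inside x) (y-in : Inside y) w →
             (X¹ x ∷ X² (below y-in) ∷ w) ≈ᶠ (X² (below x-in) ∷ X¹ y ∷ w)
  move-two {x} {y} x-in y-in w = ≈ᶠ-trans (≈ᶠ-suffix w swapped) (≈ᶠ-swap _ _ w)
    where
    swapped : (X¹ x ∷ X² (below y-in) ∷ []) ≈ᶠ (X¹ y ∷ X² (below x-in) ∷ [])
    swapped = ≡.subst₂ (λ a b → (X¹ a ∷ X² (below y-in) ∷ []) ≈ᶠ (X¹ b ∷ X² (below x-in) ∷ []))
                (ι-below x x-in) (ι-below y y-in) (swap-binomial (below y-in) (below x-in))

  -- Two consecutive factors x, y may be exchanged before relabelling with twos k: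
  -- the variables produced agree up to order, except for x, y ∈ [γ] and k = 1,
  -- where they differ by moving the superscript 2 from x to y.
  twosHead-swap : ∀ k x y → (twosHead k x ∷ twosHead (twosLeft k x) y ∷ []) ≈ᶠ (twosHead (twosLeft k y) x ∷ twosHead k y ∷ [])
  twosHead-swap k x y with Inside? x | Inside? y
  ... | no _ | _ = ≈ᶠ-refl
  ... | yes _ | no _ = ≈ᶠ-refl
  twosHead-swap zero x y | yes _ | yes _ = ≈ᶠ-refl
  twosHead-swap (suc zero) x y | yes x-in | yes y-in = ≈ᶠ-sym (move-two x-in y-in [])
  twosHead-swap (suc (suc k)) x y | yes _ | yes _ = ≈ᶠ-refl

  relabel-twos-↭ : ∀ {u w} → u ↭ w → ∀ k → relabel′ (twos k) u ≈ᶠ relabel′ (twos k) w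
  relabel-twos-↭ Perm.refl k = ≈ᶠ-refl
  relabel-twos-↭ (Perm.prep {xs = u} {ys = w} x p) k
    rewrite relabel-twos-∷ k x u | relabel-twos-∷ k x w = ≈ᶠ-∷ _ (relabel-twos-↭ p _)
  relabel-twos-↭ (Perm.swap {xs = u} {ys = w} x y p) k
    rewrite relabel-twos-∷ k x (y ∷ u) | relabel-twos-∷ (twosLeft k x) y u
          | relabel-twos-∷ k y (x ∷ w) | relabel-twos-∷ (twosLeft k y) x w =
    ≈ᶠ-trans (≈ᶠ-suffix _ (twosHead-swap k x y)) (≈ᶠ-trans (≈ᶠ-swap _ _ _) (≈ᶠ-∷ _ (≈ᶠ-∷ _ rest)))
    where
    rest : relabel′ (twos (twosLeft (twosLeft k x) y)) u ≈ᶠ relabel′ (twos (twosLeft (twosLeft k y) x)) w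
    rest = ≡.subst (λ l → relabel′ (twos (twosLeft (twosLeft k x) y)) u ≈ᶠ relabel′ (twos l) w)
             (twosLeft-comm k x y) (relabel-twos-↭ p _)
  relabel-twos-↭ (Perm.trans p q) k = ≈ᶠ-trans (relabel-twos-↭ p k) (relabel-twos-↭ q k)

  -- Normal form of monomials modulo ⟨F̃⟩: a monomial with k factors of
  -- superscript 2 is congruent to the one whose superscripts 2 sit on its
  -- first k factors with index in [γ].

  count² : List (Fin N) → ℕ
  count² w = Vec.lookup (sumV (List.map weight w)) two

  count²-X¹ : ∀ j w → count² (X¹ j ∷ w) ≡ count² w
  count²-X¹ j w = ≡.trans (lookup-⊕ (weight (X¹ j)) _ two) (cong (λ v → Vec.lookup v two ℕ.+ count² w) (weight-X¹ j))

  count²-X² : ∀ j w → count² (X² j ∷ w) ≡ suc (count² w)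
  count²-X² j w = ≡.trans (lookup-⊕ (weight (X² j)) _ two) (cong (λ v → Vec.lookup v two ℕ.+ count² w) (weight-X² j))

  count²-bound : ∀ w → count² w ≤ countIn (List.map forget w)
  count²-bound [] = ℕ.z≤n
  count²-bound (x ∷ w) with variable? x
  ... | var¹ j rewrite count²-X¹ j w | forget-X¹ j = bound-∷ (Inside? j)
    where
    bound-∷ : Dec (Inside j) → count² w ≤ countIn (j ∷ List.map forget w)
    bound-∷ (yes j-in) rewrite countIn-in (List.map forget w) j-in = ℕP.m≤n⇒m≤1+n (count²-bound w)
    bound-∷ (no j-out) rewrite countIn-out (List.map forget w) j-out = count²-bound w
  ... | var² j rewrite count²-X² j w | forget-X² j | countIn-in (List.map forget w) (ι<γ j) =
    ℕ.s≤s (count²-bound w)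

  -- x¹ⱼ·(relabelled w with k+1 twos) ≡ x²ⱼ·(relabelled w with k twos), j ∈ [γ]:
  -- the last superscript 2 moves to the front.
  push-two : ∀ k w {j} (j-in : Inside j) → suc k ≤ countIn w →
             (X¹ j ∷ relabel′ (twos (suc k)) w) ≈ᶠ (X² (below j-in) ∷ relabel′ (twos k) w)
  push-two k [] j-in ()
  push-two k (y ∷ w) j-in k<w with Inside? y
  ... | no y-out =
    ≈ᶠ-trans (≈ᶠ-swap _ _ _) (≈ᶠ-trans (≈ᶠ-∷ _ (push-two k w j-in (≡.subst (suc k ≤_) (countIn-out w y-out) k<w)))
      (≈ᶠ-swap _ _ _))
  push-two zero (y ∷ w) j-in k<w | yes y-in = move-two j-in y-in _
  push-two (suc k) (y ∷ w) j-in k<w | yes y-in =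
    ≈ᶠ-trans (≈ᶠ-swap _ _ _) (≈ᶠ-trans (≈ᶠ-∷ _ (push-two k w j-in (ℕ.s≤s⁻¹ (≡.subst (suc (suc k) ≤_) (countIn-in w y-in) k<w))))
      (≈ᶠ-swap _ _ _))

  absorb-X¹ : ∀ j k w → k ≤ countIn w → (X¹ j ∷ relabel′ (twos k) w) ≈ᶠ relabel′ (twos k) (j ∷ w)
  absorb-X¹ j k w k≤w with Inside? j
  absorb-X¹ j k w k≤w | no _ = ≈ᶠ-refl
  absorb-X¹ j zero w k≤w | yes _ = ≈ᶠ-refl
  absorb-X¹ j (suc k) w k≤w | yes j-in = push-two k w j-in k≤w

  normal-form : ∀ w → w ≈ᶠ relabel′ (twos (count² w)) (List.map forget w)
  normal-form [] = ≈ᶠ-refl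
  normal-form (x ∷ w) with variable? x
  ... | var¹ j rewrite count²-X¹ j w | forget-X¹ j =
    ≈ᶠ-trans (≈ᶠ-∷ (X¹ j) (normal-form w)) (absorb-X¹ j (count² w) (List.map forget w) (count²-bound w))
  ... | var² j rewrite count²-X² j w | forget-X² j | relabel-in (twos (suc (count² w))) (ι j) (List.map forget w) (ι<γ j)
                     | below-ι j (ι<γ j) = ≈ᶠ-∷ (X² j) (normal-form w)

  π̃-image : ∀ w → expImage π̃ (expOf w) ≡ sumV (List.map π (List.map forget w)) Vec.++ sumV (List.map weight w)
  π̃-image w = ≡.trans (expImage-expOf π̃ w) (split-sum w)
    where
    0⃗-++ : ∀ a b → Vec.replicate (a ℕ.+ b) 0 ≡ Vec.replicate a 0 Vec.++ Vec.replicate b 0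
    0⃗-++ zero b = refl
    0⃗-++ (suc a) b = cong (0 ∷_) (0⃗-++ a b)
    split-sum : ∀ w → sumV (List.map π̃ w) ≡ sumV (List.map π (List.map forget w)) Vec.++ sumV (List.map weight w)
    split-sum [] = 0⃗-++ d 2
    split-sum (x ∷ w) = ≡.trans (cong₂ _⊕_ (π̃-split x) (split-sum w))
      (VecP.zipWith-++ ℕ._+_ (π (forget x)) (weight x) (sumV (List.map π (List.map forget w))) (sumV (List.map weight w)))

  degree² : Mon N → ℕ
  degree² α = Vec.lookup (expImage π̃ α) (d ↑ʳ two)

  degree²-expOf : ∀ w → degree² (expOf w) ≡ count² w
  degree²-expOf w = ≡.trans (cong (λ v → Vec.lookup v (d ↑ʳ two)) (π̃-image w))
    (VecP.lookup-++ʳ (sumV (List.map π (List.map forget w))) (sumV (List.map weight w)) two)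

  σ : Mon N → Mon n
  σ α = expOf (List.map forget (factors α))

  lift : ℕ → Mon n → Mon N
  lift k β = expOf (relabel′ (twos k) (factors β))

  normal-form-exp : ∀ α → α ~ lift (degree² α) (σ α)
  normal-form-exp α = ≡.subst₂ (λ β k → β ~ lift k (σ α)) (expOf-factors α) (≡.sym degree≡count) congruent
    where
    w = factors α
    degree≡count : degree² α ≡ count² w
    degree≡count = ≡.trans (cong degree² (≡.sym (expOf-factors α))) (degree²-expOf w)
    congruent : expOf w ~ lift (count² w) (σ α)
    congruent = ≈ᶠ-elim (≈ᶠ-trans (normal-form w)
                  (relabel-twos-↭ (Perm.↭-sym (factors-expOf (List.map forget w))) (count² w)))

  -- If x^u − x^v ∈ F with countIn u = countIn v, then lift_k identifies
  -- x^t·x^u and x^t·x^v modulo ⟨F̃⟩: after reordering, both are relabelled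
  -- with the same first countIn u labels I, and x^{I(u)} − x^{I(v)} = f^I ∈ F̃.
  lift-generator : ∀ k t {u v} → F (u , v) → countIn u ≡ countIn v →
                   lift k (t ⊕ expOf u) ~ lift k (t ⊕ expOf v)
  lift-generator k t {u} {v} f∈F counts = ~-trans (reorder u) (~-trans middle (~-sym (reorder v)))
    where
    T = factors t

    reorder : ∀ w → lift k (t ⊕ expOf w) ~ expOf (relabel′ (twos k) (w ++ T))
    reorder w = ≈ᶠ-elim (relabel-twos-↭ factors↭ k)
      where
      factors↭ : factors (t ⊕ expOf w) ↭ w ++ T
      factors↭ = Perm.trans
        (Perm.↭-reflexive (cong factors (≡.trans (cong (_⊕ expOf w) (≡.sym (expOf-factors t))) (≡.sym (expOf-++ T w)))))
        (Perm.trans (factors-expOf (T ++ w)) (PermP.++-comm T w))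

    I = firstLabels (countIn u) (twos k)

    split : ∀ w {c} → countIn w ≡ c →
            relabel′ (twos k) (w ++ T) ≡ relabel′ (Vec.toList (firstLabels c (twos k))) w ++ relabel′ (twos (k ∸ c)) T
    split w refl = ≡.trans (relabel-++ (twos k) w T)
      (cong₂ _++_ (relabel-firstLabels (twos k) w) (cong (λ L → relabel′ L T) (drop-twos (countIn w) k)))

    middle : expOf (relabel′ (twos k) (u ++ T)) ~ expOf (relabel′ (twos k) (v ++ T))
    middle rewrite split u refl | split v (≡.sym counts) =
      ≈ᶠ-elim (≈ᶠ-suffix _ (≈ᶠ-generator (inj₁ ((u , v) , f∈F , I , refl))))

  labelWeight : List (Fin 2) → Mon 2
  labelWeight [] = 1 ∷ 0 ∷ []
  labelWeight (Fin.zero ∷ _) = 1 ∷ 0 ∷ []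
  labelWeight (Fin.suc _ ∷ _) = 0 ∷ 1 ∷ []

  weight-labelled : ∀ I x x-in → weight (labelled I x x-in) ≡ labelWeight I
  weight-labelled [] x _ = weight-X¹ x
  weight-labelled (Fin.zero ∷ _) x _ = weight-X¹ x
  weight-labelled (Fin.suc _ ∷ _) x x-in = weight-X² (below x-in)

  labelsWeight : List (Fin 2) → ℕ → Mon 2
  labelsWeight I zero = 0⃗
  labelsWeight I (suc c) = labelWeight I ⊕ labelsWeight (List.drop 1 I) c

  weight-relabel : ∀ I u → sumV (List.map weight (relabel′ I u)) ≡ (countOut u ∷ 0 ∷ []) ⊕ labelsWeight I (countIn u)
  weight-relabel I [] = refl
  weight-relabel I (j ∷ u) = by-cases (Inside? j)
    where
    by-cases : Dec (Inside j) →
      sumV (List.map weight (relabel′ I (j ∷ u))) ≡ (countOut (j ∷ u) ∷ 0 ∷ []) ⊕ labelsWeight I (countIn (j ∷ u))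
    by-cases (yes j-in)
      rewrite relabel-in I j u j-in | countOut-in u j-in | countIn-in u j-in | weight-labelled I j j-in
            | weight-relabel (List.drop 1 I) u =
      ≡.trans (≡.sym (⊕-assoc (labelWeight I) _ _))
        (≡.trans (cong (_⊕ labelsWeight (List.drop 1 I) (countIn u)) (⊕-comm (labelWeight I) _)) (⊕-assoc _ (labelWeight I) _))
    by-cases (no j-out)
      rewrite relabel-out I j u j-out | countOut-out u j-out | countIn-out u j-out | weight-X¹ j | weight-relabel I u =
      ≡.sym (⊕-assoc (1 ∷ 0 ∷ []) _ _)

  balanced-by-parts : ∀ w w' → sumV (List.map π (List.map forget w)) ≡ sumV (List.map π (List.map forget w')) →
                      sumV (List.map weight w) ≡ sumV (List.map weight w') → Balanced π̃ (w , w')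
  balanced-by-parts w w' same-π same-weight =
    ≡.trans (π̃-image w) (≡.trans (cong₂ Vec._++_ same-π same-weight) (≡.sym (π̃-image w')))

  F̃-balanced : (∀ {u v} → F (u , v) → Balanced π (u , v)) →
               (∀ {u v} → F (u , v) → countIn u ≡ countIn v × countOut u ≡ countOut v) →
               ∀ b → F̃ b → Balanced π̃ b
  F̃-balanced F-balanced F-counts _ (inj₁ ((u , v) , f∈F , I , refl)) =
    balanced-by-parts (relabel′ I′ u) (relabel′ I′ v) same-π same-weight
    where
    I′ = Vec.toList I
    same-π : sumV (List.map π (List.map forget (relabel′ I′ u))) ≡ sumV (List.map π (List.map forget (relabel′ I′ v)))
    same-π rewrite forget-relabel I′ u | forget-relabel I′ v =
      ≡.trans (≡.sym (expImage-expOf π u)) (≡.trans (F-balanced f∈F) (expImage-expOf π v))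
    same-weight : sumV (List.map weight (relabel′ I′ u)) ≡ sumV (List.map weight (relabel′ I′ v))
    same-weight rewrite weight-relabel I′ u | weight-relabel I′ v | proj₁ (F-counts f∈F) | proj₂ (F-counts f∈F) = refl
  F̃-balanced _ _ _ (inj₂ (j₁ , j₂ , _ , refl)) =
    balanced-by-parts (X¹ (ι j₂) ∷ X² j₁ ∷ []) (X¹ (ι j₁) ∷ X² j₂ ∷ []) same-π same-weight
    where
    same-π : sumV (List.map π (List.map forget (X¹ (ι j₂) ∷ X² j₁ ∷ [])))
           ≡ sumV (List.map π (List.map forget (X¹ (ι j₁) ∷ X² j₂ ∷ [])))
    same-π rewrite forget-X¹ (ι j₂) | forget-X² j₁ | forget-X¹ (ι j₁) | forget-X² j₂ =
      ≡.trans (≡.sym (⊕-assoc (π (ι j₂)) (π (ι j₁)) 0⃗))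
        (≡.trans (cong (_⊕ 0⃗) (⊕-comm (π (ι j₂)) (π (ι j₁)))) (⊕-assoc _ _ 0⃗))
    same-weight : sumV (List.map weight (X¹ (ι j₂) ∷ X² j₁ ∷ [])) ≡ sumV (List.map weight (X¹ (ι j₁) ∷ X² j₂ ∷ []))
    same-weight rewrite weight-X¹ (ι j₂) | weight-X² j₁ | weight-X¹ (ι j₁) | weight-X² j₂ = refl

  sPart : Vec ℕ (d ℕ.+ 2) → Mon d
  sPart = Vec.take d

  sPart-++ : ∀ (xs : Mon d) ys → sPart (xs Vec.++ ys) ≡ xs
  sPart-++ = take-++
    where
    take-++ : ∀ {m k} (xs : Vec ℕ m) (ys : Vec ℕ k) → Vec.take m (xs Vec.++ ys) ≡ xs
    take-++ [] ys = refl
    take-++ (x ∷ xs) ys = cong (x ∷_) (take-++ xs ys)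

  π-σ : ∀ α → expImage π (σ α) ≡ sPart (expImage π̃ α)
  π-σ α = ≡.trans (expImage-expOf π (List.map forget (factors α)))
    (≡.sym (≡.trans (cong (sPart ∘ expImage π̃) (≡.sym (expOf-factors α)))
      (≡.trans (cong sPart (π̃-image (factors α))) (sPart-++ _ _))))

  module _ (F-counts : ∀ {u v} → F (u , v) → countIn u ≡ countIn v)
           (F-spans-kernel : ∀ p → monoMap π p ≈P 0P → InIdeal F p) where

    lift-generated : ∀ k {q} → Generated F q → Generated F̃ (mapExp (lift k) q)
    lift-generated k {q} (ms , ms∈F , q≈ms) =
      Generated-resp {p = mapExp (lift k) q} {q = mapExp (lift k) (expand ms)}
        (mapExp-resp (lift k) {q} {expand ms} q≈ms) (lifted ms ms∈F)
      where
      lifted : ∀ ms → All (F ∘ generator) ms → Generated F̃ (mapExp (lift k) (expand ms))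
      lifted [] [] = Generated-zero {p = []} (λ α → ≈-refl)
      lifted ((a , t , (u , v)) ∷ ms) (f∈F ∷ fs) =
        Generated-++ {p = (a , lift k (t ⊕ expOf u)) ∷ (- a , lift k (t ⊕ expOf v)) ∷ []}
                     {q = mapExp (lift k) (expand ms)}
          (~-scaled a (lift-generator k t f∈F (F-counts f∈F))) (lifted ms fs)

    -- A kernel polynomial P of w₂-degree k lies in ⟨F̃⟩: P − lift_k(σ P) ∈ ⟨F̃⟩
    -- by the normal form, and σ P ∈ ker π = ⟨F⟩, so lift_k(σ P) ∈ ⟨F̃⟩.
    homogeneous-kernel : ∀ k P → All (λ t → degree² (proj₂ t) ≡ k) P →
                         IsZero (mapExp (expImage π̃) P) → Generated F̃ P
    homogeneous-kernel k P P-degree P↦0 =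
      Generated-resp {p = P} {q = (P ⊝ ΛP) ++ ΛP} add-back
        (Generated-++ {p = P ⊝ ΛP} {q = ΛP} (minus-congruent Λ P normal) lifted)
      where
      Λ = lift k ∘ σ
      ΛP = mapExp Λ P
      normal : All (λ t → proj₂ t ~ Λ (proj₂ t)) P
      normal = All.map (λ {t} degree≡k → ≡.subst (λ j → proj₂ t ~ lift j (σ (proj₂ t))) degree≡k (normal-form-exp (proj₂ t)))
                 P-degree
      σP↦0 : monoMap π (mapExp σ P) ≈P 0P
      σP↦0 = ≡.subst IsZero (≡.sym image-of-σP) (mapExp-zero sPart (mapExp (expImage π̃) P) P↦0)
        where
        image-of-σP : monoMap π (mapExp σ P) ≡ mapExp sPart (mapExp (expImage π̃) P)
        image-of-σP = ≡.trans (monoMap≡mapExp π (mapExp σ P)) (≡.trans (mapExp-∘ (expImage π) σ P)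
                        (≡.trans (mapExp-cong π-σ P) (≡.sym (mapExp-∘ sPart (expImage π̃) P))))
      lifted : Generated F̃ ΛP
      lifted = ≡.subst (Generated F̃) (mapExp-∘ (lift k) σ P)
                 (lift-generated k {mapExp σ P} (InIdeal⇒Generated F {mapExp σ P} (F-spans-kernel (mapExp σ P) σP↦0)))
      add-back : P ≈P ((P ⊝ ΛP) ++ ΛP)
      add-back β = begin
        coeff P β                                ≈⟨ +-identityʳ _ ⟨
        coeff P β + 0#                           ≈⟨ +-congˡ (-‿inverseˡ _) ⟨
        coeff P β + (- coeff ΛP β + coeff ΛP β)  ≈⟨ +-assoc _ _ _ ⟨
        (coeff P β + - coeff ΛP β) + coeff ΛP β  ≈⟨ +-congʳ (coeff-⊝ P ΛP β) ⟨
        coeff (P ⊝ ΛP) β + coeff ΛP β            ≈⟨ coeff-++ (P ⊝ ΛP) ΛP β ⟨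
        coeff ((P ⊝ ΛP) ++ ΛP) β                 ∎

    kernel-in-ideal : ∀ p → monoMap π̃ p ≈P 0P → InIdeal F̃ p
    kernel-in-ideal p p↦0 = Generated⇒InIdeal F̃ {p}
      (kernel-by-degree (expImage π̃) (λ β → Vec.lookup β (d ↑ʳ two)) homogeneous-kernel p
        (≡.subst IsZero (monoMap≡mapExp π̃ p) p↦0))

  -- The role of the element c: the c-th coordinate of π(x¹ⱼ) is 1 exactly
  -- when j ∉ [γ].  Hence two monomials of the same degree with the same
  -- π-image have equally many factors outside [γ], and inside [γ].
  module _ (c : Fin d) (c∉B : ∀ j → toℕ j < γ → c ∉ B j) (c∈B : ∀ j → γ ≤ toℕ j → c ∈ B j) where

    π-at-c-in : ∀ {j} → Inside j → Vec.lookup (π j) c ≡ 0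
    π-at-c-in {j} j-in = ≡.trans (VecP.lookup-map c _ (B j)) (indicator-0 (Vec.lookup (B j) c) refl)
      where
      indicator-0 : ∀ b → Vec.lookup (B j) c ≡ b → (if b then 1 else 0) ≡ 0
      indicator-0 true c∈Bj = ⊥-elim (c∉B j j-in (VecP.lookup⇒[]= c (B j) c∈Bj))
      indicator-0 false _ = refl

    π-at-c-out : ∀ {j} → ¬ Inside j → Vec.lookup (π j) c ≡ 1
    π-at-c-out {j} j-out =
      ≡.trans (VecP.lookup-map c _ (B j)) (cong (λ b → if b then 1 else 0) (VecP.[]=⇒lookup (c∈B j (ℕP.≮⇒≥ j-out))))

    π-at-c : ∀ u → Vec.lookup (sumV (List.map π u)) c ≡ countOut u
    π-at-c [] = VecP.lookup-replicate c 0
    π-at-c (j ∷ u) = ≡.trans (lookup-⊕ (π j) (sumV (List.map π u)) c) (by-cases (Inside? j))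
      where
      by-cases : Dec (Inside j) → Vec.lookup (π j) c ℕ.+ Vec.lookup (sumV (List.map π u)) c ≡ countOut (j ∷ u)
      by-cases (yes j-in) rewrite π-at-c-in j-in | countOut-in u j-in = π-at-c u
      by-cases (no j-out) rewrite π-at-c-out j-out | countOut-out u j-out = cong suc (π-at-c u)

    counts-agree : ∀ {u v} → length u ≡ length v → Balanced π (u , v) → countIn u ≡ countIn v × countOut u ≡ countOut v
    counts-agree {u} {v} same-length same-image = same-in , same-out
      where
      same-out : countOut u ≡ countOut v
      same-out = ≡.trans (≡.sym (π-at-c u))
        (≡.trans (cong (λ s → Vec.lookup s c) (≡.trans (≡.sym (expImage-expOf π u)) (≡.trans same-image (expImage-expOf π v))))
          (π-at-c v))
      same-in : countIn u ≡ countIn v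
      same-in = ℕP.+-cancelʳ-≡ (countOut u) (countIn u) (countIn v)
        (≡.trans (countIn+countOut u) (≡.trans same-length (≡.trans (≡.sym (countIn+countOut v)) (cong (countIn v ℕ.+_) (≡.sym same-out)))))

lemma2p3 : ∀ {k ℓ f : Level} (K : Field k ℓ) (d : ℕ) (M : Matroid d) (c : Fin d) →
    ¬ IsColoop M c →
    (n γ : ℕ) (γ≤n : γ ≤ n) (B : Fin n → Subset d) → IsBaseNumbering M B →
    (∀ j → toℕ j < γ → c ∉ B j) → (∀ j → γ ≤ toℕ j → c ∈ B j) →
    (F : PolyRing.Binom K n → Set f) → PolyRing.Homogeneous K F →
    PolyRing.GeneratesKernel K F (PolyRing.πImg K B) →
    PolyRing.GeneratesKernel K (PolyRing.Ftilde K γ γ≤n F) (PolyRing.π̃Img K B γ≤n)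
lemma2p3 K _ _ c _ _ _ γ≤n B _ c∉B c∈B F homogeneous F-generates p =
  ideal-in-kernel π̃ (F̃-balanced F-balanced F-counts) {p} , kernel-in-ideal (proj₁ ∘ F-counts) F-spans-kernel p
  where
  open PolyRing K
  open MonomialMaps K
  open Ideals K
  open Doubling K γ≤n B F
  -- every element of F lies in ⟨F⟩ = ker π, hence is balanced
  F-balanced : ∀ {u v} → F (u , v) → Balanced π (u , v)
  F-balanced {u} {v} f∈F = kernel-binomial-balanced π u v
    (proj₁ (F-generates ⟦ u , v ⟧) (Generated⇒InIdeal F {⟦ u , v ⟧} (Generated-generator f∈F)))
  F-counts : ∀ {u v} → F (u , v) → countIn u ≡ countIn v × countOut u ≡ countOut v
  F-counts {u} {v} f∈F = counts-agree c c∉B c∈B {u} {v} (homogeneous (u , v) f∈F) (F-balanced f∈F)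
  F-spans-kernel : ∀ q → monoMap π q ≈P 0P → InIdeal F q
  F-spans-kernel q = proj₂ (F-generates q)
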